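{- Let $n \geq 2k \geq 4$. Let $Y$ be a Boolean degree $1$ function of $J_q(n, k)$ of size $x\genfrac{[}{]}{0pt}{}{n-1}{k-1}_q$. Then, for all points (1-dimensional subspaces) $P$ of $V$, \[ 0 \leq \mathrm{wt}(P) + \frac{[k-1]}{[n-1]} \left( x - \mathrm{wt}(P) \right) \leq 1. \]
   Context: $q$ is a prime power and $V$ is an $n$-dimensional vector space over the field with $q$ elements. $J_q(n,k)$ (the Grassmann scheme) is the set of $k$-dimensional subspaces of $V$. A Boolean degree $1$ function on $J_q(n,k)$ is a function $f$ from the $k$-subspaces of $V$ to $\{0,1\}$ given by a weighting $\mathrm{wt}$ of the points (1-subspaces) of $V$ with real numbers such that for every $k$-subspace $S$, $f(S)=\mathrm{wt}(S) := \sum_{P \subseteq S} \mathrm{wt}(P) \in \{0,1\}$; the function is identified with the family $Y$ of $k$-subspaces $S$ with $f(S)=1$, and its size is $|Y|$. Here $[a] := \frac{q^a-1}{q-1}$ (the number of points in an $a$-space) and $\genfrac{[}{]}{0pt}{}{a}{b}_q := \prod_{i=1}^b \frac{[a-i+1]}{[i]}$ is the $q$-binomial coefficient, the number of $b$-subspaces of an $a$-dimensional space.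
   Formalization: The weights wt(P) of the points and the number x are rational instead of real. -}

module Defs where

open import Level using (0ℓ)
open import Data.Bool using (Bool; true; false; not; _∨_; _∧_; if_then_else_)
open import Data.Nat as ℕ using (ℕ; zero; suc)
open import Data.Integer using (+_)
open import Data.Rational as ℚ using (ℚ; 0ℚ; 1ℚ)
open import Data.Fin using (Fin)
open import Data.Vec as Vec using (Vec; []; _∷_)
open import Data.List as List using (List; []; _∷_; length; lookup; allFin; concatMap; filter)
open import Data.List.Membership.Propositional using (_∈_)
open import Data.List.Relation.Unary.Unique.Propositional using (Unique)
open import Data.Product using (Σ; ∃; _×_)
open import Relation.Binary.PropositionalEquality using (_≡_; _≢_; _≗_)
open import Relation.Nullary using (Dec)
open import Algebra.Structures using (IsCommutativeRing)
open import Function.Bundles using (_⇔_)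

record FiniteField : Set₁ where
  infixl 6 _+_
  infixl 7 _*_
  field
    Carrier   : Set
    _≟_       : (x y : Carrier) → Dec (x ≡ y)
    _+_ _*_   : Carrier → Carrier → Carrier
    -_        : Carrier → Carrier
    0# 1#     : Carrier
    isCommutativeRing : IsCommutativeRing _≡_ _+_ _*_ -_ 0# 1#
    0≢1       : 0# ≢ 1#
    inverse   : ∀ x → x ≢ 0# → ∃ λ y → x * y ≡ 1#
    elements  : List Carrier
    complete  : ∀ x → x ∈ elements
    unique    : Unique elements

  q : ℕ
  q = length elements

module VectorSpace (F : FiniteField) (n : ℕ) where
  open FiniteField F

  V : Set
  V = Vec Carrier n

  zeroV : ∀ {m} → Vec Carrier m
  zeroV = Vec.replicate _ 0#

  _+V_ : ∀ {m} → Vec Carrier m → Vec Carrier m → Vec Carrier m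
  _+V_ = Vec.zipWith _+_

  _·V_ : ∀ {m} → Carrier → Vec Carrier m → Vec Carrier m
  c ·V v = Vec.map (c *_) v

  allVecs : (m : ℕ) → List (Vec Carrier m)
  allVecs zero    = [] ∷ []
  allVecs (suc m) = concatMap (λ x → List.map (x ∷_) (allVecs m)) elements

  lincomb : ∀ {k} → Vec Carrier k → Vec V k → V
  lincomb []       []       = zeroV
  lincomb (c ∷ cs) (b ∷ bs) = (c ·V b) +V lincomb cs bs

  LinIndep : ∀ {k} → Vec V k → Set
  LinIndep {k} b = (c : Vec Carrier k) → lincomb c b ≡ zeroV → c ≡ Vec.replicate k 0#

  InSpan : ∀ {k} → Vec V k → V → Set
  InSpan {k} b v = ∃ λ (c : Vec Carrier k) → lincomb c b ≡ v

  SubsetV : Set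
  SubsetV = V → Bool

  IsSubspaceOfDim : ℕ → SubsetV → Set
  IsSubspaceOfDim k S = Σ (Vec V k) λ b → LinIndep b × (∀ v → (S v ≡ true) ⇔ InSpan b v)

  _⊆ᵇ_ : SubsetV → SubsetV → Bool
  P ⊆ᵇ S = List.foldr (λ v b → (not (P v) ∨ S v) ∧ b) true (allVecs n)

  Enumerates : (SubsetV → Set) → List SubsetV → Set
  Enumerates Prop ls =
      (∀ S → Prop S → ∃ λ i → lookup ls i ≗ S)
    × (∀ i → Prop (lookup ls i))
    × (∀ i j → lookup ls i ≗ lookup ls j → i ≡ j)

  sumℚ : List ℚ → ℚ
  sumℚ = List.foldr ℚ._+_ 0ℚ

  wtOf : (ps : List SubsetV) → (Fin (length ps) → ℚ) → SubsetV → ℚ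
  wtOf ps wt S = sumℚ (List.map (λ i → if lookup ps i ⊆ᵇ S then wt i else 0ℚ) (allFin (length ps)))

  sizeY : (ps : List SubsetV) → (Fin (length ps) → ℚ) → List SubsetV → ℕ
  sizeY ps wt ks = length (filter (λ S → wtOf ps wt S ℚ.≟ 1ℚ) ks)

-- [a] = (q^a - 1)/(q - 1) = 1 + q + ... + q^(a-1)
bracket : ℕ → ℕ → ℕ
bracket q zero    = 0
bracket q (suc a) = suc (q ℕ.* bracket q a)

-- [a] / [b] as a rational (b = 0 gives the junk value 0; never used)
qfrac : ℕ → ℕ → ℕ → ℚ
qfrac q a zero    = 0ℚ
qfrac q a (suc b) = (+ bracket q a) ℚ./ bracket q (suc b)

-- Gaussian binomial [a choose b]_q = Π_{i=1}^b [a-i+1]/[i]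
gauss : ℕ → ℕ → ℕ → ℚ
gauss q a zero    = 1ℚ
gauss q a (suc b) = gauss q a b ℚ.* qfrac q (a ℕ.∸ b) (suc b)

-- Count ordered bases. Inside a d-space an independent m-tuple extends to an independent
-- (m+j)-tuple in (q^d - q^m) ⋯ (q^d - q^(m+j-1)) ways, and each independent k-tuple of V
-- spans exactly one k-space, so an independent m-tuple lies in [n-m choose k-m] k-spaces:
-- a point in [n-1 choose k-1] of them and two distinct points in [k-1]/[n-1] times as many.
-- Summing wt(S) over all k-spaces gives |Y| = [n-1 choose k-1] Σ_P wt(P), so x is the total
-- weight; summing over the k-spaces through P gives
-- [n-1 choose k-1] (wt(P) + [k-1]/[n-1] (x - wt(P))), a sum of [n-1 choose k-1] values in {0,1}.

module Submission where

open import Defs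
open import Data.Nat using (ℕ)

module Counting where
  open import Data.Bool using (Bool; true; false; not; _∧_; if_then_else_)
  open import Data.Bool.Properties using (T-≡)
  open import Data.Nat using (ℕ; zero; suc; _+_; _*_; _∸_; _≤_; z≤n; s≤s)
  open import Data.List using (List; length)
  open import Data.Product using (_×_)
  open import Data.Nat.Properties
    using (≤-antisym; +-suc; m+n∸m≡n; *-distribʳ-+; +-commutativeSemigroup; m≤n⇒m≤1+n; suc-injective; <-irrefl)
  open import Algebra.Properties.CommutativeSemigroup +-commutativeSemigroup using (interchange)
  open import Data.Nat.ListAction using (sum)
  open import Data.Nat.ListAction.Properties using (sum-++)
  open import Data.List using ([]; _∷_; _++_; map; cartesianProductWith; filterᵇ; allFin)
  open import Data.List.Properties using (map-cong-local; map-++; length-++; map-tabulate)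
  open import Data.Fin using (Fin; zero; suc)
  open import Data.List.Membership.Propositional using (_∈_)
  open import Data.List.Membership.Propositional.Properties using (∈-∃++; ∈-filter⁺; ∈-filter⁻)
  open import Data.List.Relation.Binary.Subset.Propositional using (_⊆_)
  open import Data.List.Relation.Unary.Any using (here; there)
  import Data.List.Relation.Unary.All as All
  import Data.List.Relation.Unary.AllPairs as AllPairs
  open AllPairs using (_∷_)
  open import Data.List.Relation.Unary.Unique.Propositional using (Unique)
  import Data.List.Relation.Unary.Unique.Propositional.Properties as Unique
  open import Data.Product using (_,_)
  open import Data.Empty using (⊥-elim)
  open import Relation.Nullary.Decidable using (T?)
  open import Function using (_∘_; id; Equivalence)
  open import Relation.Binary.PropositionalEquality

  private
    variable
      A B C : Set

  count : (A → Bool) → List A → ℕ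
  count p xs = sum (map (λ x → if p x then 1 else 0) xs)

  sum-map-cong : {f g : A → ℕ} (xs : List A) → (∀ {x} → x ∈ xs → f x ≡ g x) →
                 sum (map f xs) ≡ sum (map g xs)
  sum-map-cong xs f≡g = cong sum (map-cong-local (All.tabulate f≡g))

  count-cong : {p p′ : A → Bool} (xs : List A) → (∀ {x} → x ∈ xs → p x ≡ p′ x) →
               count p xs ≡ count p′ xs
  count-cong xs p≡p′ = sum-map-cong xs (λ x∈xs → cong (λ b → if b then 1 else 0) (p≡p′ x∈xs))

  count-none : {p : A → Bool} (xs : List A) → (∀ {x} → x ∈ xs → p x ≡ false) → count p xs ≡ 0
  count-none [] _ = refl
  count-none (x ∷ xs) none rewrite none (here refl) = count-none xs (λ x∈xs → none (there x∈xs))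

  count-map : (p : B → Bool) (g : A → B) (xs : List A) → count p (map g xs) ≡ count (λ x → p (g x)) xs
  count-map p g [] = refl
  count-map p g (x ∷ xs) = cong ((if p (g x) then 1 else 0) +_) (count-map p g xs)

  count-++ : (p : A → Bool) (xs ys : List A) → count p (xs ++ ys) ≡ count p xs + count p ys
  count-++ p xs ys = trans (cong sum (map-++ _ xs ys)) (sum-++ (map _ xs) _)

  count-cartesianProductWith : (p : C → Bool) (f : A → B → C) (xs : List A) (ys : List B) →
    count p (cartesianProductWith f xs ys) ≡ sum (map (λ x → count (λ y → p (f x y)) ys) xs)
  count-cartesianProductWith p f [] ys = refl
  count-cartesianProductWith p f (x ∷ xs) ys = begin
    count p (map (f x) ys ++ cartesianProductWith f xs ys)
      ≡⟨ count-++ p (map (f x) ys) _ ⟩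
    count p (map (f x) ys) + count p (cartesianProductWith f xs ys)
      ≡⟨ cong₂ _+_ (count-map p (f x) ys) (count-cartesianProductWith p f xs ys) ⟩
    count (λ y → p (f x y)) ys + sum (map (λ x → count (λ y → p (f x y)) ys) xs) ∎
    where open ≡-Reasoning

  count-not : (p : A → Bool) (xs : List A) → count (λ x → not (p x)) xs ≡ length xs ∸ count p xs
  count-not p xs = trans (sym (m+n∸m≡n (count p xs) _)) (cong (_∸ count p xs) (complement xs))
    where
    complement : (xs : List _) → count p xs + count (λ x → not (p x)) xs ≡ length xs
    complement [] = refl
    complement (x ∷ xs) with p x
    ... | true  = cong suc (complement xs)
    ... | false = trans (+-suc _ _) (cong suc (complement xs))

  sum-map-+ : (f g : A → ℕ) (xs : List A) →
              sum (map (λ x → f x + g x) xs) ≡ sum (map f xs) + sum (map g xs)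
  sum-map-+ f g [] = refl
  sum-map-+ f g (x ∷ xs) =
    trans (cong (f x + g x +_) (sum-map-+ f g xs)) (interchange (f x) (g x) _ _)

  sum-map-zero : (xs : List A) → sum (map (λ _ → 0) xs) ≡ 0
  sum-map-zero [] = refl
  sum-map-zero (x ∷ xs) = sum-map-zero xs

  sum-swap : (g : A → B → ℕ) (xs : List A) (ys : List B) →
             sum (map (λ x → sum (map (g x) ys)) xs) ≡ sum (map (λ y → sum (map (λ x → g x y) xs)) ys)
  sum-swap g [] ys = sym (sum-map-zero ys)
  sum-swap g (x ∷ xs) ys =
    trans (cong (sum (map (g x) ys) +_) (sum-swap g xs ys))
          (sym (sum-map-+ (g x) (λ y → sum (map (λ x → g x y) xs)) ys))

  sum-map-if-* : (p : A → Bool) (c : ℕ) (xs : List A) →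
                 sum (map (λ x → (if p x then 1 else 0) * c) xs) ≡ count p xs * c
  sum-map-if-* p c [] = refl
  sum-map-if-* p c (x ∷ xs) =
    trans (cong (_ +_) (sum-map-if-* p c xs)) (sym (*-distribʳ-+ c (if p x then 1 else 0) (count p xs)))

  count-fibres : (p : A → Bool) (q : B → A → Bool) (xs : List A) (ys : List B) →
                 (∀ {x} → x ∈ xs → p x ≡ true → count (λ y → q y x) ys ≡ 1) →
                 count p xs ≡ sum (map (λ y → count (λ x → p x ∧ q y x) xs) ys)
  count-fibres p q xs ys one-fibre =
    sym (trans (sum-swap (λ y x → if p x ∧ q y x then 1 else 0) ys xs) (sum-map-cong xs fibre))
    where
    fibre : ∀ {x} → x ∈ xs → count (λ y → p x ∧ q y x) ys ≡ (if p x then 1 else 0)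
    fibre {x} x∈xs with p x in px
    ... | true  = one-fibre x∈xs px
    ... | false = sum-map-zero ys

  length-filterᵇ : (p : A → Bool) (xs : List A) → length (filterᵇ p xs) ≡ count p xs
  length-filterᵇ p [] = refl
  length-filterᵇ p (x ∷ xs) with p x
  ... | true  = cong suc (length-filterᵇ p xs)
  ... | false = length-filterᵇ p xs

  length-mono-⊆ : {xs ys : List A} → Unique xs → xs ⊆ ys → length xs ≤ length ys
  length-mono-⊆ {xs = []} _ _ = z≤n
  length-mono-⊆ {xs = x ∷ xs} (x∉xs ∷ !xs) xs⊆ys with ∈-∃++ (xs⊆ys (here refl))
  ... | ys₁ , ys₂ , refl = subst (suc (length xs) ≤_) (sym middle)
    (s≤s (length-mono-⊆ !xs (λ z∈xs → remove ys₁ (xs⊆ys (there z∈xs)) (distinct x∉xs z∈xs))))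
    where
    middle : length (ys₁ ++ x ∷ ys₂) ≡ suc (length (ys₁ ++ ys₂))
    middle = trans (length-++ ys₁) (trans (+-suc _ _) (cong suc (sym (length-++ ys₁))))
    distinct : ∀ {x z xs} → All.All (x ≢_) xs → z ∈ xs → z ≢ x
    distinct (x≢y All.∷ _) (here refl) = λ z≡x → x≢y (sym z≡x)
    distinct (_ All.∷ x≢xs) (there z∈xs) = distinct x≢xs z∈xs
    remove : ∀ {z} (ys₁ : List _) {ys₂} → z ∈ ys₁ ++ x ∷ ys₂ → z ≢ x → z ∈ ys₁ ++ ys₂
    remove [] (here refl) z≢x = ⊥-elim (z≢x refl)
    remove [] (there z∈) _ = z∈
    remove (y ∷ ys₁) (here refl) _ = here refl
    remove (y ∷ ys₁) (there z∈) z≢x = there (remove ys₁ z∈ z≢x)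

  count-unique-≡ : {p p′ : A → Bool} {xs ys : List A} → Unique xs → Unique ys →
                   (∀ {z} → z ∈ xs → p z ≡ true → z ∈ ys × p′ z ≡ true) →
                   (∀ {z} → z ∈ ys → p′ z ≡ true → z ∈ xs × p z ≡ true) →
                   count p xs ≡ count p′ ys
  count-unique-≡ {p = p} {p′} {xs} {ys} !xs !ys to from = begin
    count p xs                ≡⟨ length-filterᵇ p xs ⟨
    length (filterᵇ p xs)     ≡⟨ ≤-antisym (length-mono-⊆ (!filter p !xs) (filter-⊆ p p′ to))
                                           (length-mono-⊆ (!filter p′ !ys) (filter-⊆ p′ p from)) ⟩
    length (filterᵇ p′ ys)    ≡⟨ length-filterᵇ p′ ys ⟩
    count p′ ys               ∎
    where
    open ≡-Reasoning
    !filter : ∀ (p : A → Bool) {xs} → Unique xs → Unique (filterᵇ p xs)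
    !filter p = Unique.filter⁺ (T? ∘ p)
    filter-⊆ : ∀ (p p′ : A → Bool) {xs ys} →
               (∀ {z} → z ∈ xs → p z ≡ true → z ∈ ys × p′ z ≡ true) → filterᵇ p xs ⊆ filterᵇ p′ ys
    filter-⊆ p p′ f z∈ with ∈-filter⁻ (T? ∘ p) z∈
    ... | z∈xs , pz with f z∈xs (Equivalence.to T-≡ pz)
    ... | z∈ys , p′z = ∈-filter⁺ (T? ∘ p′) z∈ys (Equivalence.from T-≡ p′z)

  count-allFin-suc : ∀ {m} (p : Fin (suc m) → Bool) →
                     count p (allFin (suc m)) ≡ (if p zero then 1 else 0) + count (p ∘ suc) (allFin m)
  count-allFin-suc {m} p = cong (λ xs → (if p zero then 1 else 0) + sum xs)
    (trans (map-tabulate suc indicator) (sym (map-tabulate id (indicator ∘ suc))))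
    where
    indicator : Fin (suc m) → ℕ
    indicator s = if p s then 1 else 0

  distinct⇒2≤length : {xs : List A} {a b : A} → a ∈ xs → b ∈ xs → a ≢ b → 2 ≤ length xs
  distinct⇒2≤length {xs = _ ∷ []}    (here refl) (here refl) a≢b = ⊥-elim (a≢b refl)
  distinct⇒2≤length {xs = _ ∷ _ ∷ _} _           _           _   = s≤s (s≤s z≤n)

  count-true : (xs : List A) → count (λ _ → true) xs ≡ length xs
  count-true [] = refl
  count-true (x ∷ xs) = cong suc (count-true xs)

  count-≤-length : (p : A → Bool) (xs : List A) → count p xs ≤ length xs
  count-≤-length p [] = z≤n
  count-≤-length p (x ∷ xs) with p x
  ... | true  = s≤s (count-≤-length p xs)
  ... | false = m≤n⇒m≤1+n (count-≤-length p xs)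

  count-length⇒all : (p : A → Bool) (xs : List A) → count p xs ≡ length xs → ∀ {x} → x ∈ xs → p x ≡ true
  count-length⇒all p (y ∷ xs) full x∈ with p y in py
  count-length⇒all p (y ∷ xs) full (here refl) | true = py
  count-length⇒all p (y ∷ xs) full (there x∈) | true = count-length⇒all p xs (suc-injective full) x∈
  count-length⇒all p (y ∷ xs) full x∈ | false =
    ⊥-elim (<-irrefl full (s≤s (count-≤-length p xs)))

module Tuples where
  open import Data.Nat using (ℕ; zero; suc; _+_; _*_; _^_)
  open import Data.List using (List; []; _∷_; _++_; map; length; cartesianProductWith)
  open import Data.List.Properties using (length-++; length-map)
  open import Data.List.Membership.Propositional using (_∈_)
  open import Data.List.Membership.Propositional.Properties
    using (∈-cartesianProductWith⁺; ∈-cartesianProductWith⁻)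
  open import Data.List.Relation.Unary.Any using (here)
  open import Data.List.Relation.Unary.AllPairs using ([]; _∷_)
  import Data.List.Relation.Unary.All as All
  open import Data.List.Relation.Unary.Unique.Propositional using (Unique)
  import Data.List.Relation.Unary.Unique.Propositional.Properties as Unique
  open import Data.Vec using (Vec; []; _∷_)
  import Data.Vec.Properties as Vec
  open import Data.Vec.Relation.Unary.All using (All; []; _∷_)
  open import Data.Product using (_,_)
  open import Relation.Binary.PropositionalEquality

  private
    variable
      A B C : Set

  tuples : List A → (m : ℕ) → List (Vec A m)
  tuples xs zero    = [] ∷ []
  tuples xs (suc m) = cartesianProductWith _∷_ xs (tuples xs m)

  ∈-tuples⁺ : (xs : List A) {m : ℕ} {v : Vec A m} → All (_∈ xs) v → v ∈ tuples xs m
  ∈-tuples⁺ xs [] = here refl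
  ∈-tuples⁺ xs (x∈xs ∷ v∈) = ∈-cartesianProductWith⁺ _∷_ x∈xs (∈-tuples⁺ xs v∈)

  ∈-tuples⁻ : (xs : List A) {m : ℕ} {v : Vec A m} → v ∈ tuples xs m → All (_∈ xs) v
  ∈-tuples⁻ xs {zero} {[]} _ = []
  ∈-tuples⁻ xs {suc m} v∈ with ∈-cartesianProductWith⁻ _∷_ xs (tuples xs m) v∈
  ... | _ , _ , x∈xs , w∈ , refl = x∈xs ∷ ∈-tuples⁻ xs w∈

  tuples-unique : {xs : List A} → Unique xs → (m : ℕ) → Unique (tuples xs m)
  tuples-unique !xs zero    = All.[] ∷ []
  tuples-unique !xs (suc m) =
    Unique.cartesianProductWith⁺ _∷_ Vec.∷-injective !xs (tuples-unique !xs m)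

  length-cartesianProductWith : (f : A → B → C) (xs : List A) (ys : List B) →
    length (cartesianProductWith f xs ys) ≡ length xs * length ys
  length-cartesianProductWith f [] ys = refl
  length-cartesianProductWith f (x ∷ xs) ys =
    trans (length-++ (map (f x) ys))
          (cong₂ _+_ (length-map (f x) ys) (length-cartesianProductWith f xs ys))

  length-tuples : (xs : List A) (m : ℕ) → length (tuples xs m) ≡ length xs ^ m
  length-tuples xs zero    = refl
  length-tuples xs (suc m) =
    trans (length-cartesianProductWith _∷_ xs (tuples xs m)) (cong (length xs *_) (length-tuples xs m))

module BooleanReflection where
  open import Data.Bool using (Bool; true; false)
  open import Function using (_∘_; _⇔_; mk⇔; Equivalence)
  open import Relation.Nullary using (¬_; Dec; yes; no; does)
  open import Relation.Nullary.Decidable using (dec-true)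
  open import Relation.Binary.PropositionalEquality

  private
    variable
      A : Set

  does⇒ : (a? : Dec A) → does a? ≡ true → A
  does⇒ (yes a) _ = a

  does≡false⇒¬ : (a? : Dec A) → does a? ≡ false → ¬ A
  does≡false⇒¬ (no ¬a) _ = ¬a

  does⇔ : (a? : Dec A) → does a? ≡ true ⇔ A
  does⇔ a? = mk⇔ (does⇒ a?) (dec-true a?)

  ≡true-injective : {a b : Bool} → a ≡ true ⇔ b ≡ true → a ≡ b
  ≡true-injective {true}  {true}  _ = refl
  ≡true-injective {true}  {false} a⇔b = sym (Equivalence.to a⇔b refl)
  ≡true-injective {false} {true}  a⇔b = Equivalence.from a⇔b refl
  ≡true-injective {false} {false} _ = refl

  ≡does : {b : Bool} (a? : Dec A) → b ≡ true ⇔ A → b ≡ does a?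
  ≡does a? b⇔A = ≡true-injective (mk⇔ (dec-true a? ∘ Equivalence.to b⇔A) (Equivalence.from b⇔A ∘ does⇒ a?))

module QNumbers (q : ℕ) where
  open import Data.Nat
  open import Data.Nat.Properties
  open import Data.Nat.Solver using (module +-*-Solver)
  open import Algebra.Properties.CommutativeSemigroup *-commutativeSemigroup using (interchange; x∙yz≈y∙xz)
  open import Relation.Binary.PropositionalEquality using (_≡_; refl; sym; trans; cong; cong₂; subst; module ≡-Reasoning)
  open ≡-Reasoning

  [_] : ℕ → ℕ
  [_] = bracket q

  falling : ℕ → ℕ → ℕ
  falling a zero    = 1
  falling a (suc b) = falling a b * [ a ∸ b ]

  falling-suc : ∀ a b → falling (suc a) (suc b) ≡ [ suc a ] * falling a b
  falling-suc a zero    = trans (*-identityˡ _) (sym (*-identityʳ _))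
  falling-suc a (suc b) = begin
    falling (suc a) (suc b) * [ a ∸ b ]   ≡⟨ cong (_* [ a ∸ b ]) (falling-suc a b) ⟩
    [ suc a ] * falling a b * [ a ∸ b ]   ≡⟨ *-assoc [ suc a ] (falling a b) [ a ∸ b ] ⟩
    [ suc a ] * falling a (suc b)         ∎

  falling-nonZero : ∀ {a b} → b ≤ a → NonZero (falling a b)
  falling-nonZero {a} {zero} _ = _
  falling-nonZero {a} {suc b} b<a with a ∸ b | m<n⇒0<n∸m b<a
  ... | suc c | _ = m*n≢0 (falling a b) [ suc c ] {{falling-nonZero (<⇒≤ b<a)}}

  bracket-geometric : ∀ p c → p * bracket (suc p) c + 1 ≡ suc p ^ c
  bracket-geometric p zero    = cong (_+ 1) (*-zeroʳ p)
  bracket-geometric p (suc c) = begin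
    p * suc (suc p * bracket (suc p) c) + 1 ≡⟨ solve 2 (λ p b → p :* (con 1 :+ (con 1 :+ p) :* b) :+ con 1
                                                  := (con 1 :+ p) :* (p :* b :+ con 1)) refl p (bracket (suc p) c) ⟩
    suc p * (p * bracket (suc p) c + 1)     ≡⟨ cong (suc p *_) (bracket-geometric p c) ⟩
    suc p * suc p ^ c                       ∎
    where open +-*-Solver

  -- (q^d - q^m) (q^d - q^(m+1)) ⋯ (q^d - q^(m+j-1)): the number of ways to extend
  -- an independent m-tuple by j vectors of a d-space to an independent tuple.
  extensions : ℕ → ℕ → ℕ → ℕ
  extensions d m zero    = 1
  extensions d m (suc j) = extensions d m j * (q ^ d ∸ q ^ (j + m))

  powerFactor : ℕ → ℕ → ℕ
  powerFactor m zero    = 1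
  powerFactor m (suc j) = powerFactor m j * (q ^ (j + m) * pred q)

  module _ .{{_ : NonZero q}} where

    geometric : ∀ c → pred q * [ c ] + 1 ≡ q ^ c
    geometric c = subst (λ r → pred r * bracket r c + 1 ≡ r ^ c) (suc-pred q) (bracket-geometric (pred q) c)

    pow-∸-pow : ∀ {d e} → e ≤ d → q ^ d ∸ q ^ e ≡ q ^ e * pred q * [ d ∸ e ]
    pow-∸-pow {d} {e} e≤d = begin
      q ^ d ∸ q ^ e                   ≡⟨ cong (λ d → q ^ d ∸ q ^ e) (sym (m+[n∸m]≡n e≤d)) ⟩
      q ^ (e + c) ∸ q ^ e             ≡⟨ cong₂ _∸_ (^-distribˡ-+-* q e c) (sym (*-identityʳ (q ^ e))) ⟩
      q ^ e * q ^ c ∸ q ^ e * 1       ≡⟨ *-distribˡ-∸ (q ^ e) (q ^ c) 1 ⟨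
      q ^ e * (q ^ c ∸ 1)             ≡⟨ cong (λ r → q ^ e * (r ∸ 1)) (geometric c) ⟨
      q ^ e * (pred q * [ c ] + 1 ∸ 1) ≡⟨ cong (q ^ e *_) (m+n∸n≡m (pred q * [ c ]) 1) ⟩
      q ^ e * (pred q * [ c ])        ≡⟨ *-assoc (q ^ e) (pred q) [ c ] ⟨
      q ^ e * pred q * [ c ]          ∎
      where c = d ∸ e

    extensions-factor : ∀ d m j → j + m ≤ d → extensions d m j ≡ powerFactor m j * falling (d ∸ m) j
    extensions-factor d m zero    _ = refl
    extensions-factor d m (suc j) j+m<d = begin
      extensions d m j * (q ^ d ∸ q ^ (j + m))
        ≡⟨ cong₂ _*_ (extensions-factor d m j (<⇒≤ j+m<d)) (pow-∸-pow (<⇒≤ j+m<d)) ⟩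
      powerFactor m j * falling (d ∸ m) j * (q ^ (j + m) * pred q * [ d ∸ (j + m) ])
        ≡⟨ cong (λ r → powerFactor m j * falling (d ∸ m) j * (q ^ (j + m) * pred q * [ r ])) d∸[j+m]≡d∸m∸j ⟩
      powerFactor m j * falling (d ∸ m) j * (q ^ (j + m) * pred q * [ d ∸ m ∸ j ])
        ≡⟨ interchange (powerFactor m j) (falling (d ∸ m) j) (q ^ (j + m) * pred q) [ d ∸ m ∸ j ] ⟩
      powerFactor m (suc j) * falling (d ∸ m) (suc j) ∎
      where
      d∸[j+m]≡d∸m∸j : d ∸ (j + m) ≡ d ∸ m ∸ j
      d∸[j+m]≡d∸m∸j = trans (cong (d ∸_) (+-comm j m)) (sym (∸-+-assoc d m j))

    powerFactor-nonZero : .{{NonZero (pred q)}} → ∀ m j → NonZero (powerFactor m j)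
    powerFactor-nonZero m zero    = _
    powerFactor-nonZero m (suc j) =
      m*n≢0 (powerFactor m j) (q ^ (j + m) * pred q)
        {{powerFactor-nonZero m j}} {{m*n≢0 (q ^ (j + m)) (pred q) {{m^n≢0 q (j + m)}}}}

    extensions-cancel : .{{NonZero (pred q)}} → ∀ {N n m j} → j + m ≤ n →
      N * extensions (j + m) m j ≡ extensions n m j → N * falling j j ≡ falling (n ∸ m) j
    extensions-cancel {N} {n} {m} {j} j+m≤n eq = *-cancelˡ-≡ _ _ (powerFactor m j) {{powerFactor-nonZero m j}} (begin
      powerFactor m j * (N * falling j j)             ≡⟨ x∙yz≈y∙xz (powerFactor m j) N (falling j j) ⟩
      N * (powerFactor m j * falling j j)             ≡⟨ cong (λ r → N * (powerFactor m j * falling r j)) (m+n∸n≡m j m) ⟨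
      N * (powerFactor m j * falling (j + m ∸ m) j)   ≡⟨ cong (N *_) (extensions-factor (j + m) m j ≤-refl) ⟨
      N * extensions (j + m) m j                      ≡⟨ eq ⟩
      extensions n m j                                ≡⟨ extensions-factor n m j j+m≤n ⟩
      powerFactor m j * falling (n ∸ m) j             ∎)

module LinearAlgebra (F : FiniteField) (n : ℕ) where
  open import Data.Nat using (zero; suc; _^_)
  open import Data.Bool as Bool using (Bool)
  open import Data.List as List using (List; []; _∷_; map; length; concatMap; cartesianProductWith)
  open import Data.List.Properties using (length-map)
  open import Data.List.Membership.Propositional using (_∈_; lose)
  open import Data.List.Membership.Propositional.Properties using (∈-map⁺; ∈-map⁻)
  import Data.List.Relation.Unary.Unique.Propositional.Properties as Unique
  import Data.List.Relation.Unary.All as All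
  import Data.List.Relation.Unary.Any as Any
  open import Data.List.Relation.Unary.Unique.Propositional using (Unique)
  open import Data.Vec as Vec using (Vec; []; _∷_; _++_)
  import Data.Vec.Properties as Vec
  open import Data.Vec.Relation.Unary.All using (All; []; _∷_; universal) renaming (map to mapAll)
  open import Data.Product using (_,_)
  open import Data.Empty using (⊥-elim)
  open import Relation.Nullary using (¬_; Dec; yes; no; does)
  open import Relation.Nullary.Decidable using (map′; _→-dec_)
  open import Relation.Binary.PropositionalEquality
  open import Algebra.Bundles using (CommutativeRing)

  open Tuples
  open FiniteField F
  open VectorSpace F n

  commutativeRing : CommutativeRing _ _
  commutativeRing = record { isCommutativeRing = isCommutativeRing }

  open CommutativeRing commutativeRing
    using (+-assoc; +-comm; +-identityˡ; +-identityʳ; -‿inverseˡ; -‿inverseʳ; zeroˡ; zeroʳ;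
           *-identityˡ; *-assoc; *-comm; distribˡ; distribʳ; +-commutativeSemigroup)
  open import Algebra.Properties.Ring (CommutativeRing.ring commutativeRing) using (-1*x≈-x; -‿involutive; -0#≈0#)
  open import Algebra.Properties.CommutativeSemigroup +-commutativeSemigroup using (interchange)

  private
    variable
      m l : ℕ

  +V-identityˡ : (x : Vec Carrier m) → zeroV +V x ≡ x
  +V-identityˡ = Vec.zipWith-identityˡ +-identityˡ

  +V-identityʳ : (x : Vec Carrier m) → x +V zeroV ≡ x
  +V-identityʳ = Vec.zipWith-identityʳ +-identityʳ

  +V-comm : (x y : Vec Carrier m) → x +V y ≡ y +V x
  +V-comm = Vec.zipWith-comm +-comm

  +V-interchange : (a b c d : Vec Carrier m) → (a +V b) +V (c +V d) ≡ (a +V c) +V (b +V d)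
  +V-interchange [] [] [] [] = refl
  +V-interchange (a ∷ as) (b ∷ bs) (c ∷ cs) (d ∷ ds) =
    cong₂ _∷_ (interchange a b c d) (+V-interchange as bs cs ds)

  ·V-distribˡ : (a : Carrier) (x y : Vec Carrier m) → a ·V (x +V y) ≡ (a ·V x) +V (a ·V y)
  ·V-distribˡ a [] [] = refl
  ·V-distribˡ a (b ∷ x) (c ∷ y) = cong₂ _∷_ (distribˡ a b c) (·V-distribˡ a x y)

  ·V-distribʳ : (a b : Carrier) (x : Vec Carrier m) → (a + b) ·V x ≡ (a ·V x) +V (b ·V x)
  ·V-distribʳ a b [] = refl
  ·V-distribʳ a b (c ∷ x) = cong₂ _∷_ (distribʳ c a b) (·V-distribʳ a b x)

  ·V-assoc : (a b : Carrier) (x : Vec Carrier m) → (a * b) ·V x ≡ a ·V (b ·V x)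
  ·V-assoc a b [] = refl
  ·V-assoc a b (c ∷ x) = cong₂ _∷_ (*-assoc a b c) (·V-assoc a b x)

  ·V-identityˡ : (x : Vec Carrier m) → 1# ·V x ≡ x
  ·V-identityˡ [] = refl
  ·V-identityˡ (c ∷ x) = cong₂ _∷_ (*-identityˡ c) (·V-identityˡ x)

  ·V-zeroˡ : (x : Vec Carrier m) → 0# ·V x ≡ zeroV
  ·V-zeroˡ [] = refl
  ·V-zeroˡ (c ∷ x) = cong₂ _∷_ (zeroˡ c) (·V-zeroˡ x)

  ·V-zeroʳ : (a : Carrier) → a ·V zeroV {m} ≡ zeroV
  ·V-zeroʳ {zero}  a = refl
  ·V-zeroʳ {suc m} a = cong₂ _∷_ (zeroʳ a) (·V-zeroʳ a)

  +V-inverseʳ : (x : Vec Carrier m) → x +V ((- 1#) ·V x) ≡ zeroV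
  +V-inverseʳ [] = refl
  +V-inverseʳ (a ∷ x) = cong₂ _∷_ (trans (cong (a +_) (-1*x≈-x a)) (-‿inverseʳ a)) (+V-inverseʳ x)

  +V-cancel : (x y : Vec Carrier m) → x +V ((- 1#) ·V y) ≡ zeroV → x ≡ y
  +V-cancel [] [] _ = refl
  +V-cancel (a ∷ x) (b ∷ y) eq = cong₂ _∷_ a≡b (+V-cancel x y (Vec.∷-injectiveʳ eq))
    where
    a≡b : a ≡ b
    a≡b = begin
      a                         ≡⟨ +-identityʳ a ⟨
      a + 0#                    ≡⟨ cong (a +_) (-‿inverseˡ b) ⟨
      a + (- b + b)             ≡⟨ +-assoc a (- b) b ⟨
      a + - b + b               ≡⟨ cong (λ c → a + c + b) (-1*x≈-x b) ⟨
      a + (- 1#) * b + b        ≡⟨ cong (_+ b) (Vec.∷-injectiveˡ eq) ⟩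
      0# + b                    ≡⟨ +-identityˡ b ⟩
      b                         ∎
      where open ≡-Reasoning

  lincomb-+ : (c d : Vec Carrier m) (b : Vec V m) → lincomb (c +V d) b ≡ lincomb c b +V lincomb d b
  lincomb-+ [] [] [] = sym (+V-identityˡ zeroV)
  lincomb-+ (c ∷ cs) (d ∷ ds) (x ∷ b) =
    trans (cong₂ _+V_ (·V-distribʳ c d x) (lincomb-+ cs ds b)) (+V-interchange (c ·V x) (d ·V x) _ _)

  lincomb-· : (a : Carrier) (c : Vec Carrier m) (b : Vec V m) → lincomb (a ·V c) b ≡ a ·V lincomb c b
  lincomb-· a [] [] = sym (·V-zeroʳ a)
  lincomb-· a (c ∷ cs) (x ∷ b) =
    trans (cong₂ _+V_ (·V-assoc a c x) (lincomb-· a cs b)) (sym (·V-distribˡ a (c ·V x) _))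

  lincomb-zero : (b : Vec V m) → lincomb zeroV b ≡ zeroV
  lincomb-zero [] = refl
  lincomb-zero (x ∷ b) = trans (cong₂ _+V_ (·V-zeroˡ x) (lincomb-zero b)) (+V-identityˡ zeroV)

  lincomb-injective : {b : Vec V m} → LinIndep b → ∀ {c d} → lincomb c b ≡ lincomb d b → c ≡ d
  lincomb-injective {b = b} li {c} {d} eq = +V-cancel c d (li _ (begin
    lincomb (c +V ((- 1#) ·V d)) b             ≡⟨ lincomb-+ c _ b ⟩
    lincomb c b +V lincomb ((- 1#) ·V d) b     ≡⟨ cong (lincomb c b +V_) (lincomb-· (- 1#) d b) ⟩
    lincomb c b +V ((- 1#) ·V lincomb d b)     ≡⟨ cong (λ v → lincomb c b +V ((- 1#) ·V v)) eq ⟨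
    lincomb c b +V ((- 1#) ·V lincomb c b)     ≡⟨ +V-inverseʳ (lincomb c b) ⟩
    zeroV                                      ∎))
    where open ≡-Reasoning

  +V-≡zero : (x y : Vec Carrier m) → x +V y ≡ zeroV → x ≡ (- 1#) ·V y
  +V-≡zero x y eq = +V-cancel x ((- 1#) ·V y) (trans (cong (x +V_) neg-neg) eq)
    where
    neg-neg : (- 1#) ·V ((- 1#) ·V y) ≡ y
    neg-neg = begin
      (- 1#) ·V ((- 1#) ·V y)   ≡⟨ ·V-assoc (- 1#) (- 1#) y ⟨
      ((- 1#) * (- 1#)) ·V y    ≡⟨ cong (_·V y) (trans (-1*x≈-x (- 1#)) (-‿involutive 1#)) ⟩
      1# ·V y                   ≡⟨ ·V-identityˡ y ⟩
      y                         ∎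
      where open ≡-Reasoning

  span-head : (v : V) (t : Vec V m) → InSpan (v ∷ t) v
  span-head v t = (1# ∷ zeroV) , trans (cong₂ _+V_ (·V-identityˡ v) (lincomb-zero t)) (+V-identityʳ v)

  span-∷ : (v : V) {t : Vec V m} {x : V} → InSpan t x → InSpan (v ∷ t) x
  span-∷ v (c , eq) = (0# ∷ c) , trans (cong₂ _+V_ (·V-zeroˡ v) eq) (+V-identityˡ _)

  span-entries : (t : Vec V m) → All (InSpan t) t
  span-entries []      = []
  span-entries (v ∷ t) = span-head v t ∷ mapAll (span-∷ v) (span-entries t)

  span-zero : (b : Vec V m) → InSpan b zeroV
  span-zero b = zeroV , lincomb-zero b

  span-+ : {b : Vec V m} {x y : V} → InSpan b x → InSpan b y → InSpan b (x +V y)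
  span-+ {b = b} (c , refl) (d , refl) = (c +V d) , lincomb-+ c d b

  span-· : {b : Vec V m} (a : Carrier) {x : V} → InSpan b x → InSpan b (a ·V x)
  span-· {b = b} a (c , refl) = (a ·V c) , lincomb-· a c b

  span-lincomb : {b : Vec V m} {t : Vec V l} → All (InSpan b) t → ∀ c → InSpan b (lincomb c t)
  span-lincomb {b = b} []       []       = span-zero b
  span-lincomb         (x∈ ∷ t∈) (c ∷ cs) = span-+ (span-· c x∈) (span-lincomb t∈ cs)

  linIndep-tail : {v : V} {t : Vec V m} → LinIndep (v ∷ t) → LinIndep t
  linIndep-tail {v = v} li c eq =
    Vec.∷-injectiveʳ (li (0# ∷ c) (trans (cong₂ _+V_ (·V-zeroˡ v) eq) (+V-identityˡ zeroV)))

  linIndep⇒∉span : {v : V} {t : Vec V m} → LinIndep (v ∷ t) → ¬ InSpan t v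
  linIndep⇒∉span {v = v} li (c , refl) = 0≢1 (begin
    0#          ≡⟨ -0#≈0# ⟨
    - 0#        ≡⟨ cong -_ (Vec.∷-injectiveˡ (li ((- 1#) ∷ c) vanishes)) ⟨
    - (- 1#)    ≡⟨ -‿involutive 1# ⟩
    1#          ∎)
    where
    open ≡-Reasoning
    vanishes : ((- 1#) ·V v) +V v ≡ zeroV
    vanishes = trans (+V-comm _ v) (+V-inverseʳ v)

  linIndep-∷ : {v : V} {t : Vec V m} → LinIndep t → ¬ InSpan t v → LinIndep (v ∷ t)
  linIndep-∷ {v = v} {t} li v∉ (a ∷ c) eq with a ≟ 0#
  ... | yes refl = cong (0# ∷_) (li c (trans (sym (trans (cong (_+V lincomb c t) (·V-zeroˡ v)) (+V-identityˡ _))) eq))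
  ... | no a≢0 with inverse a a≢0
  ... | b , ab≡1 = ⊥-elim (v∉ (((b * (- 1#)) ·V c) , in-span))
    where
    open ≡-Reasoning
    in-span : lincomb ((b * (- 1#)) ·V c) t ≡ v
    in-span = begin
      lincomb ((b * (- 1#)) ·V c) t       ≡⟨ lincomb-· (b * (- 1#)) c t ⟩
      (b * (- 1#)) ·V lincomb c t         ≡⟨ ·V-assoc b (- 1#) _ ⟩
      b ·V ((- 1#) ·V lincomb c t)        ≡⟨ cong (b ·V_) (+V-≡zero _ _ eq) ⟨
      b ·V (a ·V v)                       ≡⟨ ·V-assoc b a v ⟨
      (b * a) ·V v                        ≡⟨ cong (_·V v) (trans (*-comm b a) ab≡1) ⟩
      1# ·V v                             ≡⟨ ·V-identityˡ v ⟩
      v                                   ∎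

  span-singleton-sym : {x y : V} → LinIndep (y ∷ []) → InSpan (x ∷ []) y → InSpan (y ∷ []) x
  span-singleton-sym {x} {y} li-y ((c ∷ []) , eq) with c ≟ 0#
  ... | yes refl = ⊥-elim (linIndep⇒∉span li-y ([] , sym y≡0))
    where
    y≡0 : y ≡ zeroV
    y≡0 = trans (sym eq) (trans (+V-identityʳ _) (·V-zeroˡ x))
  ... | no c≢0 with inverse c c≢0
  ... | d , cd≡1 = (d ∷ []) , (begin
      (d ·V y) +V zeroV      ≡⟨ +V-identityʳ _ ⟩
      d ·V y                 ≡⟨ cong (d ·V_) (trans (sym eq) (+V-identityʳ _)) ⟩
      d ·V (c ·V x)          ≡⟨ ·V-assoc d c x ⟨
      (d * c) ·V x           ≡⟨ cong (_·V x) (trans (*-comm d c) cd≡1) ⟩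
      1# ·V x                ≡⟨ ·V-identityˡ x ⟩
      x                      ∎)
    where open ≡-Reasoning

  allVecs≡tuples : ∀ m → allVecs m ≡ tuples elements m
  allVecs≡tuples zero    = refl
  allVecs≡tuples (suc m) = trans (concatMap≡ elements) (cong (cartesianProductWith _∷_ elements) (allVecs≡tuples m))
    where
    concatMap≡ : ∀ xs → concatMap (λ x → map (x ∷_) (allVecs m)) xs ≡ cartesianProductWith _∷_ xs (allVecs m)
    concatMap≡ []       = refl
    concatMap≡ (x ∷ xs) = cong (map (x ∷_) (allVecs m) List.++_) (concatMap≡ xs)

  ∈-allVecs : (v : Vec Carrier m) → v ∈ allVecs m
  ∈-allVecs {m} v = subst (v ∈_) (sym (allVecs≡tuples m)) (∈-tuples⁺ elements (universal complete v))

  allVecs-unique : ∀ m → Unique (allVecs m)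
  allVecs-unique m = subst Unique (sym (allVecs≡tuples m)) (tuples-unique unique m)

  length-allVecs : ∀ m → length (allVecs m) ≡ q ^ m
  length-allVecs m = trans (cong length (allVecs≡tuples m)) (length-tuples elements m)

  _≟V_ : (x y : Vec Carrier m) → Dec (x ≡ y)
  _≟V_ = Vec.≡-dec _≟_

  inSpan? : (t : Vec V m) (v : V) → Dec (InSpan t v)
  inSpan? t v = map′ Any.satisfied (λ (c , eq) → lose (∈-allVecs c) eq)
                     (Any.any? (λ c → lincomb c t ≟V v) (allVecs _))

  linIndep? : (t : Vec V m) → Dec (LinIndep t)
  linIndep? t = map′ (λ all c → All.lookup all (∈-allVecs c)) (λ li → All.tabulate (λ {c} _ → li c))
                     (All.all? (λ c → (lincomb c t ≟V zeroV) →-dec (c ≟V zeroV)) (allVecs _))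

  inSpanᵇ : Vec V m → V → Bool
  inSpanᵇ t v = does (inSpan? t v)

  linIndepᵇ : Vec V m → Bool
  linIndepᵇ t = does (linIndep? t)

  _≗?_ : (S T : SubsetV) → Dec (S ≗ T)
  S ≗? T = map′ (λ all v → All.lookup all (∈-allVecs v)) (λ S≗T → All.tabulate (λ {v} _ → S≗T v))
                (All.all? (λ v → S v Bool.≟ T v) (allVecs n))

  spanList : Vec V m → List V
  spanList t = map (λ c → lincomb c t) (allVecs _)

  ∈-spanList⁺ : {t : Vec V m} {v : V} → InSpan t v → v ∈ spanList t
  ∈-spanList⁺ {t = t} (c , refl) = ∈-map⁺ (λ c → lincomb c t) (∈-allVecs c)

  ∈-spanList⁻ : {t : Vec V m} {v : V} → v ∈ spanList t → InSpan t v
  ∈-spanList⁻ {t = t} v∈ with ∈-map⁻ (λ c → lincomb c t) v∈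
  ... | c , _ , refl = c , refl

  spanList-unique : {t : Vec V m} → LinIndep t → Unique (spanList t)
  spanList-unique li = Unique.map⁺ (lincomb-injective li) (allVecs-unique _)

  length-spanList : (t : Vec V m) → length (spanList t) ≡ q ^ m
  length-spanList {m} t = trans (length-map _ (allVecs m)) (length-allVecs m)

module SubspaceCounting (F : FiniteField) (n : ℕ) where
  open import Data.Nat using (zero; suc; pred; _+_; _*_; _∸_; _^_; _≤_; NonZero)
  open import Data.Nat.Properties using (*-identityˡ)
  open import Data.Nat.ListAction using (sum)
  open import Data.Bool using (Bool; true; false; not; _∧_; if_then_else_)
  open import Data.List using (List; []; _∷_; map; length; lookup; allFin; cartesianProductWith)
  open import Data.List.Membership.Propositional using (_∈_)
  open import Data.List.Membership.Propositional.Properties using (∈-allFin)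
  open import Data.List.Relation.Unary.Any using (here)
  open import Data.List.Relation.Unary.Unique.Propositional using (Unique)
  import Data.List.Relation.Unary.Unique.Propositional.Properties as Unique
  import Data.List.Relation.Unary.AllPairs as AllPairs
  open AllPairs using (_∷_)
  import Data.List.Relation.Unary.All as ListAll
  open import Data.Vec using (Vec; []; _∷_; _++_)
  open import Data.Vec.Relation.Unary.All using (All; []; _∷_; universal) renaming (map to mapAll)
  import Data.Vec.Relation.Unary.All.Properties as All
  open import Data.Product using (_×_; _,_; proj₁; proj₂)
  open import Function using (_∘_; _⇔_; mk⇔; Equivalence)
  open import Relation.Nullary using (¬_; Dec; does; ¬?; _×-dec_)
  open import Relation.Nullary.Decidable using (dec-true; dec-false; does-⇔)
  open import Relation.Binary.PropositionalEquality

  open BooleanReflection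
  open Counting
  open Tuples
  open FiniteField F using (q)
  open VectorSpace F n
  open LinearAlgebra F n
  open QNumbers q

  private
    variable
      d l m : ℕ

  record ListedSubspace (d : ℕ) : Set where
    field
      vectors        : List V
      vectors-unique : Unique vectors
      length-vectors : length vectors ≡ q ^ d
      lincomb-closed : ∀ {l} (t : Vec V l) → All (_∈ vectors) t → ∀ c → lincomb c t ∈ vectors

  wholeSpace : ListedSubspace n
  wholeSpace = record
    { vectors        = allVecs n
    ; vectors-unique = allVecs-unique n
    ; length-vectors = length-allVecs n
    ; lincomb-closed = λ t _ c → ∈-allVecs (lincomb c t)
    }

  spannedBy : (b : Vec V d) → LinIndep b → ListedSubspace d
  spannedBy b li = record
    { vectors        = spanList b
    ; vectors-unique = spanList-unique li
    ; length-vectors = length-spanList b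
    ; lincomb-closed = λ t t∈ c → ∈-spanList⁺ (span-lincomb (mapAll ∈-spanList⁻ t∈) c)
    }

  module _ (W : ListedSubspace d) where
    open ListedSubspace W

    count-inSpan : (t : Vec V l) → All (_∈ vectors) t → LinIndep t → count (inSpanᵇ t) vectors ≡ q ^ l
    count-inSpan {l} t t∈W li = begin
      count (inSpanᵇ t) vectors          ≡⟨ count-unique-≡ vectors-unique (spanList-unique li) to from ⟩
      count (λ _ → true) (spanList t)    ≡⟨ count-true (spanList t) ⟩
      length (spanList t)                ≡⟨ length-spanList t ⟩
      q ^ l                              ∎
      where
      open ≡-Reasoning
      to : ∀ {v} → v ∈ vectors → inSpanᵇ t v ≡ true → v ∈ spanList t × true ≡ true
      to _ v∈span = ∈-spanList⁺ (does⇒ (inSpan? t _) v∈span) , refl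
      from : ∀ {v} → v ∈ spanList t → true ≡ true → v ∈ vectors × inSpanᵇ t v ≡ true
      from v∈ _ with ∈-spanList⁻ v∈
      ... | c , refl = lincomb-closed t t∈W c , dec-true (inSpan? t _) (c , refl)

    count-extensions₁ : (t : Vec V l) → All (_∈ vectors) t →
      count (λ v → linIndepᵇ (v ∷ t)) vectors ≡ (if linIndepᵇ t then 1 else 0) * (q ^ d ∸ q ^ l)
    count-extensions₁ {l} t t∈W with linIndepᵇ t in indep
    ... | false = count-none vectors (λ {v} _ → dec-false (linIndep? (v ∷ t)) (¬li ∘ linIndep-tail))
      where ¬li = does≡false⇒¬ (linIndep? t) indep
    ... | true = begin
      count (λ v → linIndepᵇ (v ∷ t)) vectors       ≡⟨ count-cong vectors (λ {v} _ → does-⇔ (indep⇔∉ v) (linIndep? (v ∷ t)) (¬? (inSpan? t v))) ⟩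
      count (λ v → not (inSpanᵇ t v)) vectors       ≡⟨ count-not (inSpanᵇ t) vectors ⟩
      length vectors ∸ count (inSpanᵇ t) vectors    ≡⟨ cong₂ _∸_ length-vectors (count-inSpan t t∈W li) ⟩
      q ^ d ∸ q ^ l                                 ≡⟨ *-identityˡ _ ⟨
      1 * (q ^ d ∸ q ^ l)                           ∎
      where
      open ≡-Reasoning
      li : LinIndep t
      li = does⇒ (linIndep? t) indep
      indep⇔∉ : ∀ v → LinIndep (v ∷ t) ⇔ (¬ InSpan t v)
      indep⇔∉ v = mk⇔ linIndep⇒∉span (linIndep-∷ li)

    count-extensions : (u : Vec V m) → All (_∈ vectors) u → LinIndep u → ∀ j →
      count (λ w → linIndepᵇ (w ++ u)) (tuples vectors j) ≡ extensions d m j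
    count-extensions u u∈W li zero rewrite dec-true (linIndep? u) li = refl
    count-extensions {m} u u∈W li (suc j) = begin
      count (λ w → linIndepᵇ (w ++ u)) (cartesianProductWith _∷_ vectors T)
        ≡⟨ count-cartesianProductWith (λ w → linIndepᵇ (w ++ u)) _∷_ vectors T ⟩
      sum (map (λ x → count (λ w → linIndepᵇ (x ∷ (w ++ u))) T) vectors)
        ≡⟨ sum-swap (λ x w → if linIndepᵇ (x ∷ (w ++ u)) then 1 else 0) vectors T ⟩
      sum (map (λ w → count (λ x → linIndepᵇ (x ∷ (w ++ u))) vectors) T)
        ≡⟨ sum-map-cong T (λ w∈ → count-extensions₁ (_ ++ u) (All.++⁺ (∈-tuples⁻ vectors w∈) u∈W)) ⟩
      sum (map (λ w → (if linIndepᵇ (w ++ u) then 1 else 0) * (q ^ d ∸ q ^ (j + m))) T)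
        ≡⟨ sum-map-if-* (λ w → linIndepᵇ (w ++ u)) _ T ⟩
      count (λ w → linIndepᵇ (w ++ u)) T * (q ^ d ∸ q ^ (j + m))
        ≡⟨ cong (_* (q ^ d ∸ q ^ (j + m))) (count-extensions u u∈W li j) ⟩
      extensions d m (suc j) ∎
      where
      open ≡-Reasoning
      T = tuples vectors j

  allInᵇ : SubsetV → Vec V m → Bool
  allInᵇ S []      = true
  allInᵇ S (x ∷ u) = S x ∧ allInᵇ S u

  allInᵇ⇒ : (S : SubsetV) (u : Vec V m) → allInᵇ S u ≡ true → All (λ x → S x ≡ true) u
  allInᵇ⇒ S []      _ = []
  allInᵇ⇒ S (x ∷ u) h with S x in Sx
  ... | true = Sx ∷ allInᵇ⇒ S u h

  allInᵇ⇐ : (S : SubsetV) {u : Vec V m} → All (λ x → S x ≡ true) u → allInᵇ S u ≡ true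
  allInᵇ⇐ S []          = refl
  allInᵇ⇐ S (Sx ∷ S⊇u) rewrite Sx = allInᵇ⇐ S S⊇u

  spans? : (S : SubsetV) (t : Vec V l) → Dec (LinIndep t × S ≗ inSpanᵇ t)
  spans? S t = linIndep? t ×-dec (S ≗? inSpanᵇ t)

  entries-⊆ : {S : SubsetV} (t : Vec V l) → S ≗ inSpanᵇ t → All (λ x → S x ≡ true) t
  entries-⊆ t S≗span = mapAll (λ x∈span → trans (S≗span _) (dec-true (inSpan? t _) x∈span)) (span-entries t)

  -- The ordered bases w ++ u of S are the independent extensions of u inside S.
  count-bases : ∀ {j} (S : SubsetV) → IsSubspaceOfDim (j + m) S → (u : Vec V m) → LinIndep u →
                count (λ w → does (spans? S (w ++ u))) (tuples (allVecs n) j)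
                ≡ (if allInᵇ S u then 1 else 0) * extensions (j + m) m j
  count-bases {m = m} {j = j} S (b , li-b , S⇔span) u li-u with allInᵇ S u in S⊇u
  ... | false = count-none (tuples (allVecs n) j) (λ {w} _ → dec-false (spans? S (w ++ u)) λ (_ , S≗span) →
        false≢true (trans (sym S⊇u) (allInᵇ⇐ S (proj₂ (All.++⁻ w (entries-⊆ (w ++ u) S≗span))))))
    where
    false≢true : false ≢ true
    false≢true ()
  ... | true = begin
    count (λ w → does (spans? S (w ++ u))) (tuples (allVecs n) j)
      ≡⟨ count-unique-≡ (tuples-unique (allVecs-unique n) j) (tuples-unique (spanList-unique li-b) j) to from ⟩
    count (λ w → linIndepᵇ (w ++ u)) (tuples (spanList b) j)
      ≡⟨ count-extensions (spannedBy b li-b) u u⊆b li-u j ⟩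
    extensions (j + m) m j
      ≡⟨ *-identityˡ _ ⟨
    1 * extensions (j + m) m j ∎
    where
    open ≡-Reasoning
    S⇒∈span : ∀ {x} → S x ≡ true → x ∈ spanList b
    S⇒∈span {x} = ∈-spanList⁺ ∘ Equivalence.to (S⇔span x)
    u⊆b : All (_∈ spanList b) u
    u⊆b = mapAll S⇒∈span (allInᵇ⇒ S u S⊇u)
    to : ∀ {w} → w ∈ tuples (allVecs n) j → does (spans? S (w ++ u)) ≡ true →
         w ∈ tuples (spanList b) j × linIndepᵇ (w ++ u) ≡ true
    to {w} _ spans with does⇒ (spans? S (w ++ u)) spans
    ... | li , S≗span = ∈-tuples⁺ (spanList b) (mapAll S⇒∈span (proj₁ (All.++⁻ w (entries-⊆ (w ++ u) S≗span))))
                      , dec-true (linIndep? (w ++ u)) li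
    from : ∀ {w} → w ∈ tuples (spanList b) j → linIndepᵇ (w ++ u) ≡ true →
           w ∈ tuples (allVecs n) j × does (spans? S (w ++ u)) ≡ true
    from {w} w∈ indep = ∈-tuples⁺ (allVecs n) (universal ∈-allVecs w) , dec-true (spans? S t) (li , S≗span)
      where
      t = w ++ u
      li = does⇒ (linIndep? t) indep
      t⊆b : All (_∈ spanList b) t
      t⊆b = All.++⁺ (∈-tuples⁻ (spanList b) w∈) u⊆b
      t-spans-b : count (inSpanᵇ t) (spanList b) ≡ length (spanList b)
      t-spans-b = trans (count-inSpan (spannedBy b li-b) t t⊆b li) (sym (length-spanList b))
      b⇔t : ∀ v → InSpan b v ⇔ InSpan t v
      b⇔t v = mk⇔ (λ v∈b → does⇒ (inSpan? t v) (count-length⇒all (inSpanᵇ t) (spanList b) t-spans-b (∈-spanList⁺ v∈b)))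
                  (λ { (c , refl) → span-lincomb (mapAll ∈-spanList⁻ t⊆b) c })
      S≗span : S ≗ inSpanᵇ t
      S≗span v = trans (≡does (inSpan? b v) (S⇔span v)) (does-⇔ (b⇔t v) (inSpan? b v) (inSpan? t v))

  containing : List SubsetV → Vec V m → ℕ
  containing ks u = count (λ s → allInᵇ (lookup ks s) u) (allFin (length ks))

  count-spanned : (ks : List SubsetV) → Enumerates (IsSubspaceOfDim l) ks → {t : Vec V l} → LinIndep t →
                  count (λ s → does (lookup ks s ≗? inSpanᵇ t)) (allFin (length ks)) ≡ 1
  count-spanned ks (enumerated , _ , distinct) {t} li =
    count-unique-≡ (Unique.allFin⁺ (length ks)) (ListAll.[] ∷ AllPairs.[]) to from
    where
    s₀,spans = enumerated (inSpanᵇ t) (t , li , λ v → does⇔ (inSpan? t v))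
    s₀ = proj₁ s₀,spans
    to : ∀ {s} → s ∈ allFin (length ks) → does (lookup ks s ≗? inSpanᵇ t) ≡ true → s ∈ s₀ ∷ [] × true ≡ true
    to {s} _ spans = here (distinct s s₀ λ v → trans (does⇒ (lookup ks s ≗? inSpanᵇ t) spans v) (sym (proj₂ s₀,spans v))) , refl
    from : ∀ {s} → s ∈ s₀ ∷ [] → true ≡ true → s ∈ allFin (length ks) × does (lookup ks s ≗? inSpanᵇ t) ≡ true
    from (here refl) _ = ∈-allFin s₀ , dec-true (lookup ks s₀ ≗? inSpanᵇ t) (proj₂ s₀,spans)

  containing-extensions : ∀ {j k} → j + m ≡ k → (ks : List SubsetV) → Enumerates (IsSubspaceOfDim k) ks →
    (u : Vec V m) → LinIndep u → containing ks u * extensions k m j ≡ extensions n m j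
  containing-extensions {m} {j} refl ks en@(_ , ks-subspaces , _) u li = begin
    containing ks u * extensions (j + m) m j
      ≡⟨ sum-map-if-* (λ s → allInᵇ (lookup ks s) u) _ (allFin (length ks)) ⟨
    sum (map (λ s → (if allInᵇ (lookup ks s) u then 1 else 0) * extensions (j + m) m j) (allFin (length ks)))
      ≡⟨ sum-map-cong (allFin (length ks)) (λ {s} _ → count-bases (lookup ks s) (ks-subspaces s) u li) ⟨
    sum (map (λ s → count (λ w → does (spans? (lookup ks s) (w ++ u))) (tuples (allVecs n) j)) (allFin (length ks)))
      ≡⟨ count-fibres (λ w → linIndepᵇ (w ++ u)) (λ s w → does (lookup ks s ≗? inSpanᵇ (w ++ u)))
                      (tuples (allVecs n) j) (allFin (length ks)) (λ {w} _ indep → count-spanned ks en (does⇒ (linIndep? (w ++ u)) indep)) ⟨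
    count (λ w → linIndepᵇ (w ++ u)) (tuples (allVecs n) j)
      ≡⟨ count-extensions wholeSpace u (universal ∈-allVecs u) li j ⟩
    extensions n m j ∎
    where open ≡-Reasoning

  containing-falling : .{{_ : NonZero q}} .{{_ : NonZero (pred q)}} → ∀ {j k} → j + m ≡ k → k ≤ n →
    (ks : List SubsetV) → Enumerates (IsSubspaceOfDim k) ks →
    (u : Vec V m) → LinIndep u → containing ks u * falling j j ≡ falling (n ∸ m) j
  containing-falling {m} {j} refl k≤n ks en u li =
    extensions-cancel {containing ks u} {n} {m} {j} k≤n (containing-extensions refl ks en u li)

module Points (F : FiniteField) (n : ℕ) where
  open import Data.Bool using (true; false; not; _∧_; _∨_)
  open import Data.Fin using (Fin)
  open import Data.List as List using (List; []; _∷_; length; lookup)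
  open import Data.List.Membership.Propositional using (_∈_)
  open import Data.List.Relation.Unary.Any using (here; there)
  open import Data.Vec using (Vec; []; _∷_)
  open import Data.Vec.Relation.Unary.All using ([]; _∷_) renaming (map to mapAll)
  open import Data.Product using (Σ; _×_; _,_; proj₁; proj₂)
  open import Function using (_∘_; _⇔_; mk⇔; Equivalence)
  open import Relation.Binary.PropositionalEquality

  open BooleanReflection
  open VectorSpace F n
  open LinearAlgebra F n
  open SubspaceCounting F n using (allInᵇ; allInᵇ⇒; allInᵇ⇐)

  private
    variable
      k m : ℕ

  ∧-≡true : ∀ {a b} → a ∧ b ≡ true → a ≡ true × b ≡ true
  ∧-≡true {true} {true} _ = refl , refl

  module _ {P S : SubsetV} where

    ⊆ᵇ-fold⇒ : ∀ xs → List.foldr (λ v b → (not (P v) ∨ S v) ∧ b) true xs ≡ true →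
               ∀ {v} → v ∈ xs → P v ≡ true → S v ≡ true
    ⊆ᵇ-fold⇒ (x ∷ xs) all (here refl) Px rewrite Px = proj₁ (∧-≡true all)
    ⊆ᵇ-fold⇒ (x ∷ xs) all (there v∈) Px = ⊆ᵇ-fold⇒ xs (proj₂ (∧-≡true {not (P x) ∨ S x} all)) v∈ Px

    ⊆ᵇ-fold⇐ : ∀ xs → (∀ {v} → v ∈ xs → P v ≡ true → S v ≡ true) →
               List.foldr (λ v b → (not (P v) ∨ S v) ∧ b) true xs ≡ true
    ⊆ᵇ-fold⇐ [] _ = refl
    ⊆ᵇ-fold⇐ (x ∷ xs) P⊆S with P x in Px
    ... | false = ⊆ᵇ-fold⇐ xs (P⊆S ∘ there)
    ... | true rewrite P⊆S (here refl) Px = ⊆ᵇ-fold⇐ xs (P⊆S ∘ there)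

    ⊆ᵇ⇔ : (P ⊆ᵇ S) ≡ true ⇔ (∀ v → P v ≡ true → S v ≡ true)
    ⊆ᵇ⇔ = mk⇔ (λ P⊆S v → ⊆ᵇ-fold⇒ (allVecs n) P⊆S (∈-allVecs v))
              (λ P⊆S → ⊆ᵇ-fold⇐ (allVecs n) (λ {v} _ → P⊆S v))

  ⊆ᵇ-spanned : {P S : SubsetV} (u : Vec V m) → (∀ v → (P v ≡ true) ⇔ InSpan u v) →
               IsSubspaceOfDim k S → (P ⊆ᵇ S) ≡ allInᵇ S u
  ⊆ᵇ-spanned {P = P} {S} u P⇔span (b , _ , S⇔span) = ≡true-injective (mk⇔
    (λ P⊆S → allInᵇ⇐ S (mapAll (λ x∈u → Equivalence.to (⊆ᵇ⇔ {P} {S}) P⊆S _ (Equivalence.from (P⇔span _) x∈u)) (span-entries u)))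
    (λ u⊆S → Equivalence.from (⊆ᵇ⇔ {P} {S}) (λ v Pv → spanned⊆S u⊆S (Equivalence.to (P⇔span v) Pv))))
    where
    spanned⊆S : allInᵇ S u ≡ true → ∀ {v} → InSpan u v → S v ≡ true
    spanned⊆S u⊆S (c , refl) = Equivalence.from (S⇔span _)
      (span-lincomb (mapAll (λ {x} Sx → Equivalence.to (S⇔span x) Sx) (allInᵇ⇒ S u u⊆S)) c)

  point-generator : {P : SubsetV} → IsSubspaceOfDim 1 P →
                    Σ V λ x → LinIndep (x ∷ []) × (∀ v → (P v ≡ true) ⇔ InSpan (x ∷ []) v)
  point-generator ((x ∷ []) , li , P⇔span) = x , li , P⇔span

  module _ (ps : List SubsetV) (enP : Enumerates (IsSubspaceOfDim 1) ps) where
    private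
      isPoint = proj₁ (proj₂ enP)
      distinct = proj₂ (proj₂ enP)

    generator : Fin (length ps) → V
    generator i = proj₁ (point-generator (isPoint i))

    independent : ∀ i → LinIndep (generator i ∷ [])
    independent i = proj₁ (proj₂ (point-generator (isPoint i)))

    generates : ∀ i v → (lookup ps i v ≡ true) ⇔ InSpan (generator i ∷ []) v
    generates i = proj₂ (proj₂ (point-generator (isPoint i)))

    generators-independent : ∀ {i j} → i ≢ j → LinIndep (generator i ∷ generator j ∷ [])
    generators-independent {i} {j} i≢j = linIndep-∷ (independent j) λ xᵢ∈⟨xⱼ⟩ →
      i≢j (distinct i j λ v → ≡true-injective (mk⇔
        (Equivalence.from (generates j v) ∘ widen xᵢ∈⟨xⱼ⟩ ∘ Equivalence.to (generates i v))
        (Equivalence.from (generates i v) ∘ widen (span-singleton-sym (independent i) xᵢ∈⟨xⱼ⟩) ∘ Equivalence.to (generates j v))))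
      where
      widen : ∀ {x y v} → InSpan (y ∷ []) x → InSpan (x ∷ []) v → InSpan (y ∷ []) v
      widen x∈⟨y⟩ (c , refl) = span-lincomb (x∈⟨y⟩ ∷ []) c

module RationalSums where
  open import Data.Nat as ℕ using (zero; suc)
  open import Data.Integer as ℤ using (+_)
  import Data.Integer.Properties as ℤ
  open import Data.Integer.Solver using (module +-*-Solver)
  open import Data.Rational.Solver renaming (module +-*-Solver to ℚ-Solver)
  open import Data.Rational using (ℚ; 0ℚ; 1ℚ; _/_; _+_; _*_; _-_; _≤_; Positive; toℚᵘ)
  open import Data.Rational.Properties
  import Data.Rational.Unnormalised as ℚᵘ
  import Data.Rational.Unnormalised.Properties as ℚᵘ
  open import Data.Bool using (Bool; true; false; if_then_else_)
  open import Data.Fin using (Fin; zero; suc; punchIn)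
  open import Data.Fin.Properties using (punchInᵢ≢i)
  open import Data.List as List using (List; []; _∷_; tabulate; allFin; map; filter; length)
  open import Data.List.Properties using (map-tabulate)
  open import Data.List.Membership.Propositional using (_∈_)
  open import Data.List.Relation.Unary.Any using (here; there)
  import Data.Vec.Functional as Vector
  open import Data.Vec.Functional using (Vector; removeAt)
  open import Data.Sum using (_⊎_; inj₁; inj₂)
  open import Data.Product using (_×_; _,_)
  open import Function using (_∘_; id)
  open import Relation.Nullary using (yes; no)
  open import Relation.Nullary.Negation using (contradiction)
  open import Relation.Binary.PropositionalEquality
  open import Algebra.Bundles using (CommutativeRing)
  open import Algebra.Properties.Semiring.Sum (CommutativeRing.semiring +-*-commutativeRing) public
    using (sum; sum-syntax; ∑-comm; sum-cong-≗; sum-remove; sum-replicate-zero; *-distribˡ-sum)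

  open Counting using (count)

  private
    variable
      A : Set
      m : ℕ

  -- Abstract, so that unification never unfolds the gcd normalisation inside _/_.
  abstract
    toℚ : ℕ → ℚ
    toℚ a = + a / 1

    private
      toℚᵘ-/ : ∀ a d → toℚᵘ (+ a / suc d) ℚᵘ.≃ ℚᵘ.mkℚᵘ (+ a) d
      toℚᵘ-/ a d = toℚᵘ-fromℚᵘ (ℚᵘ.mkℚᵘ (+ a) d)

    toℚ-+ : ∀ a b → toℚ (a ℕ.+ b) ≡ toℚ a + toℚ b
    toℚ-+ a b = toℚᵘ-injective (ℚᵘ.≃-trans (toℚᵘ-/ (a ℕ.+ b) 0) (ℚᵘ.≃-sym
      (ℚᵘ.≃-trans (toℚᵘ-homo-+ (toℚ a) (toℚ b)) (ℚᵘ.≃-trans (ℚᵘ.+-cong (toℚᵘ-/ a 0) (toℚᵘ-/ b 0)) (ℚᵘ.*≡* eq)))))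
      where
      open +-*-Solver
      eq : (+ a ℤ.* + 1 ℤ.+ + b ℤ.* + 1) ℤ.* + 1 ≡ + (a ℕ.+ b) ℤ.* (+ 1 ℤ.* + 1)
      eq = trans (solve 2 (λ x y → (x :* con (+ 1) :+ y :* con (+ 1)) :* con (+ 1) := (x :+ y) :* (con (+ 1) :* con (+ 1))) refl (+ a) (+ b))
                 (cong (ℤ._* (+ 1 ℤ.* + 1)) (sym (ℤ.pos-+ a b)))

    toℚ-* : ∀ a b → toℚ (a ℕ.* b) ≡ toℚ a * toℚ b
    toℚ-* a b = toℚᵘ-injective (ℚᵘ.≃-trans (toℚᵘ-/ (a ℕ.* b) 0) (ℚᵘ.≃-sym
      (ℚᵘ.≃-trans (toℚᵘ-homo-* (toℚ a) (toℚ b)) (ℚᵘ.≃-trans (ℚᵘ.*-cong (toℚᵘ-/ a 0) (toℚᵘ-/ b 0)) (ℚᵘ.*≡* eq)))))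
      where
      open +-*-Solver
      eq : (+ a ℤ.* + b) ℤ.* + 1 ≡ + (a ℕ.* b) ℤ.* (+ 1 ℤ.* + 1)
      eq = trans (solve 2 (λ x y → (x :* y) :* con (+ 1) := (x :* y) :* (con (+ 1) :* con (+ 1))) refl (+ a) (+ b))
                 (cong (ℤ._* (+ 1 ℤ.* + 1)) (sym (ℤ.pos-* a b)))

    /-*-cancel : ∀ a b → (+ a / suc b) * toℚ (suc b) ≡ toℚ a
    /-*-cancel a b = toℚᵘ-injective (ℚᵘ.≃-trans (toℚᵘ-homo-* (+ a / suc b) (toℚ (suc b)))
      (ℚᵘ.≃-trans (ℚᵘ.*-cong (toℚᵘ-/ a b) (toℚᵘ-/ (suc b) 0)) (ℚᵘ.≃-sym (ℚᵘ.≃-trans (toℚᵘ-/ a 0) (ℚᵘ.*≡* eq)))))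
      where
      open +-*-Solver
      eq : + a ℤ.* (+ suc b ℤ.* + 1) ≡ (+ a ℤ.* + suc b) ℤ.* + 1
      eq = solve 2 (λ x y → x :* (y :* con (+ 1)) := (x :* y) :* con (+ 1)) refl (+ a) (+ suc b)

    toℚ-positive : ∀ a → .{{ℕ.NonZero a}} → Positive (toℚ a)
    toℚ-positive (suc a) = normalize-pos (suc a) 1

    /1≡toℚ : ∀ a → + a / 1 ≡ toℚ a
    /1≡toℚ a = refl

    toℚ-0 : toℚ 0 ≡ 0ℚ
    toℚ-0 = refl

    toℚ-1 : toℚ 1 ≡ 1ℚ
    toℚ-1 = refl


  *-cancelʳ-≡-pos : ∀ {a b} c → .{{Positive c}} → a * c ≡ b * c → a ≡ b
  *-cancelʳ-≡-pos c eq = ≤-antisym (*-cancelʳ-≤-pos c (≤-reflexive eq)) (*-cancelʳ-≤-pos c (≤-reflexive (sym eq)))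

  foldr-tabulate : (_∙_ : A → A → A) (ε : A) (f : Fin m → A) →
                   List.foldr _∙_ ε (tabulate f) ≡ Vector.foldr _∙_ ε f
  foldr-tabulate {m = zero}  _∙_ ε f = refl
  foldr-tabulate {m = suc m} _∙_ ε f = cong (f zero ∙_) (foldr-tabulate _∙_ ε (f ∘ suc))

  foldr-map-allFin : (f : Fin m → ℚ) → List.foldr _+_ 0ℚ (map f (allFin m)) ≡ sum f
  foldr-map-allFin f = trans (cong (List.foldr _+_ 0ℚ) (map-tabulate id f)) (foldr-tabulate _+_ 0ℚ f)

  foldr-map-lookup : (xs : List A) (f : A → ℚ) → List.foldr _+_ 0ℚ (map f xs) ≡ ∑[ i < length xs ] f (List.lookup xs i)
  foldr-map-lookup []       f = refl
  foldr-map-lookup (x ∷ xs) f = cong (λ t → f x + t) (foldr-map-lookup xs f)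

  sum-if : (b : Fin m → Bool) (c : ℚ) → ∑[ s < m ] (if b s then c else 0ℚ) ≡ toℚ (count b (allFin m)) * c
  sum-if {zero}  b c = sym (trans (cong (_* c) toℚ-0) (*-zeroˡ c))
  sum-if {suc m} b c = begin
    (if b zero then c else 0ℚ) + ∑[ s < m ] (if b (suc s) then c else 0ℚ)
      ≡⟨ cong (λ t → (if b zero then c else 0ℚ) + t) (sum-if (b ∘ suc) c) ⟩
    (if b zero then c else 0ℚ) + toℚ (count (b ∘ suc) (allFin m)) * c
      ≡⟨ head-case (b zero) ⟩
    toℚ ((if b zero then 1 else 0) ℕ.+ count (b ∘ suc) (allFin m)) * c
      ≡⟨ cong (λ k → toℚ k * c) (Counting.count-allFin-suc b) ⟨
    toℚ (count b (allFin (suc m))) * c ∎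
    where
    open ≡-Reasoning
    head-case : ∀ β → (if β then c else 0ℚ) + toℚ (count (b ∘ suc) (allFin m)) * c
                    ≡ toℚ ((if β then 1 else 0) ℕ.+ count (b ∘ suc) (allFin m)) * c
    head-case true  = begin
      c + t * c               ≡⟨ cong (_+ t * c) (*-identityˡ c) ⟨
      1ℚ * c + t * c          ≡⟨ *-distribʳ-+ c 1ℚ t ⟨
      (1ℚ + t) * c            ≡⟨ cong (λ r → (r + t) * c) toℚ-1 ⟨
      (toℚ 1 + t) * c         ≡⟨ cong (_* c) (toℚ-+ 1 _) ⟨
      toℚ (1 ℕ.+ count (b ∘ suc) (allFin m)) * c ∎
      where t = toℚ (count (b ∘ suc) (allFin m))
    head-case false = +-identityˡ _

  sum-if-bounds : (b : Fin m → Bool) (f : Fin m → ℚ) → (∀ s → 0ℚ ≤ f s × f s ≤ 1ℚ) →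
    0ℚ ≤ ∑[ s < m ] (if b s then f s else 0ℚ) × ∑[ s < m ] (if b s then f s else 0ℚ) ≤ toℚ (count b (allFin m))
  sum-if-bounds {zero}  b f f∈[0,1] = ≤-refl , ≤-reflexive (sym toℚ-0)
  sum-if-bounds {suc m} b f f∈[0,1]
    rewrite Counting.count-allFin-suc b with sum-if-bounds (b ∘ suc) (f ∘ suc) (f∈[0,1] ∘ suc) | f∈[0,1] zero
  ... | 0≤rest , rest≤ | 0≤f₀ , f₀≤1 with b zero
  ... | true  = +-mono-≤ 0≤f₀ 0≤rest , subst (f zero + rest ≤_) (sym (toℚ-+ 1 _)) (+-mono-≤ (subst (f zero ≤_) (sym toℚ-1) f₀≤1) rest≤)
    where rest = ∑[ s < m ] (if b (suc s) then f (suc s) else 0ℚ)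
  ... | false = subst (0ℚ ≤_) (sym (+-identityˡ rest)) 0≤rest , subst (_≤ toℚ (count (b ∘ suc) (allFin m))) (sym (+-identityˡ rest)) rest≤
    where rest = ∑[ s < m ] (if b (suc s) then f (suc s) else 0ℚ)

  sum-except : (f g : Vector ℚ m) (i : Fin m) → (∀ j → j ≢ i → f j ≡ g j) → sum f ≡ f i + (sum g - g i)
  sum-except {suc m} f g i f≡g = begin
    sum f                                  ≡⟨ sum-remove f ⟩
    f i + sum (removeAt f i)               ≡⟨ cong (λ t → f i + t) (sum-cong-≗ (λ j → f≡g (punchIn i j) (punchInᵢ≢i i j))) ⟩
    f i + sum (removeAt g i)               ≡⟨ cong (λ t → f i + t) (solve 2 (λ a s → s := a :+ s :- a) refl (g i) _) ⟩
    f i + (g i + sum (removeAt g i) - g i) ≡⟨ cong (λ t → f i + (t - g i)) (sum-remove g) ⟨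
    f i + (sum g - g i)                    ∎
    where
    open ≡-Reasoning
    open ℚ-Solver

  count-ones : (w : A → ℚ) (xs : List A) → (∀ {x} → x ∈ xs → w x ≡ 0ℚ ⊎ w x ≡ 1ℚ) →
             toℚ (length (filter (λ x → w x ≟ 1ℚ) xs)) ≡ List.foldr _+_ 0ℚ (map w xs)
  count-ones w []       _     = toℚ-0
  count-ones w (x ∷ xs) w∈01 with w x ≟ 1ℚ | w∈01 (here refl)
  ... | yes wx≡1 | _ = begin
    toℚ (1 ℕ.+ length (filter (λ x → w x ≟ 1ℚ) xs))           ≡⟨ toℚ-+ 1 _ ⟩
    toℚ 1 + toℚ (length (filter (λ x → w x ≟ 1ℚ) xs))         ≡⟨ cong₂ _+_ (trans toℚ-1 (sym wx≡1)) (count-ones w xs (w∈01 ∘ there)) ⟩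
    w x + List.foldr _+_ 0ℚ (map w xs)                          ∎
    where open ≡-Reasoning
  ... | no wx≢1 | inj₂ wx≡1 = contradiction wx≡1 wx≢1
  ... | no _    | inj₁ wx≡0 = begin
    toℚ (length (filter (λ x → w x ≟ 1ℚ) xs))   ≡⟨ count-ones w xs (w∈01 ∘ there) ⟩
    List.foldr _+_ 0ℚ (map w xs)                  ≡⟨ +-identityˡ _ ⟨
    0ℚ + List.foldr _+_ 0ℚ (map w xs)             ≡⟨ cong (_+ List.foldr _+_ 0ℚ (map w xs)) wx≡0 ⟨
    w x + List.foldr _+_ 0ℚ (map w xs)            ∎
    where open ≡-Reasoning

module GaussianBinomials (q : ℕ) where
  open import Data.Nat as ℕ using (suc)
  open import Data.Rational using (_*_)
  open import Data.Rational.Properties using (*-identityˡ; *-comm; +-*-commutativeRing)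
  open import Algebra.Bundles using (CommutativeRing)
  open import Algebra.Properties.CommutativeSemigroup (CommutativeRing.*-commutativeSemigroup +-*-commutativeRing)
    using (interchange)
  open import Relation.Binary.PropositionalEquality using (_≡_; trans; cong; cong₂; module ≡-Reasoning)

  open QNumbers q
  open RationalSums

  qfrac-* : ∀ a b → qfrac q a (suc b) * toℚ [ suc b ] ≡ toℚ [ a ]
  qfrac-* a b = /-*-cancel [ a ] (q ℕ.* [ b ])

  gauss-falling : ∀ a b → gauss q a b * toℚ (falling b b) ≡ toℚ (falling a b)
  gauss-falling a ℕ.zero    = *-identityˡ _
  gauss-falling a (suc b) = begin
    gauss q a b * qfrac q (a ℕ.∸ b) (suc b) * toℚ (falling (suc b) (suc b))
      ≡⟨ cong (gauss q a b * qfrac q (a ℕ.∸ b) (suc b) *_) (trans (cong toℚ (falling-suc b b)) (toℚ-* [ suc b ] _)) ⟩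
    gauss q a b * qfrac q (a ℕ.∸ b) (suc b) * (toℚ [ suc b ] * toℚ (falling b b))
      ≡⟨ cong (gauss q a b * qfrac q (a ℕ.∸ b) (suc b) *_) (*-comm (toℚ [ suc b ]) _) ⟩
    gauss q a b * qfrac q (a ℕ.∸ b) (suc b) * (toℚ (falling b b) * toℚ [ suc b ])
      ≡⟨ interchange (gauss q a b) _ (toℚ (falling b b)) _ ⟩
    gauss q a b * toℚ (falling b b) * (qfrac q (a ℕ.∸ b) (suc b) * toℚ [ suc b ])
      ≡⟨ cong₂ _*_ (gauss-falling a b) (qfrac-* (a ℕ.∸ b) b) ⟩
    toℚ (falling a b) * toℚ [ a ℕ.∸ b ]
      ≡⟨ toℚ-* (falling a b) _ ⟨
    toℚ (falling a (suc b)) ∎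
    where open ≡-Reasoning

module PointWeights (F : FiniteField) (n′ k′ : ℕ) (k≤n : k′ Data.Nat.≤ n′) where
  open import Data.Nat as ℕ using (suc; pred; _*_; _≤_; s≤s; z≤n; NonZero)
  open import Data.Nat.Properties using (+-comm; *-comm; *-assoc; *-cancelʳ-≡; m*n≢0⇒m≢0; ≤-refl; ≤-trans; pred-mono-≤)
  open import Data.Rational using (ℚ; 0ℚ; 1ℚ; _+_; _-_; Positive) renaming (_*_ to _*ℚ_; _≤_ to _≤ℚ_)
  import Data.Rational.Properties as ℚ
  open import Data.Rational.Solver renaming (module +-*-Solver to ℚ-Solver)
  open import Data.Bool using (Bool; true; false; _∧_; if_then_else_)
  open import Data.Bool.Properties using (∧-identityʳ; ∧-idem)
  open import Data.Fin using (Fin)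
  open import Data.List using (List; []; _∷_; length; lookup; allFin)
  open import Data.List.Membership.Propositional using (_∈_)
  open import Data.List.Relation.Unary.Any using (index)
  open import Data.List.Relation.Unary.Any.Properties using (lookup-index)
  open import Data.Vec using ([]; _∷_)
  open import Data.Sum using (_⊎_; inj₁; inj₂)
  open import Data.Product using (_×_; _,_; proj₁; proj₂)
  open import Function using (_∘_)
  open import Relation.Binary.PropositionalEquality hiding ([_])

  n k : ℕ
  n = suc (suc n′)
  k = suc (suc k′)

  open FiniteField F using (q; complete; 0≢1)
  open VectorSpace F n
  open Counting using (count; count-cong; distinct⇒2≤length)
  open QNumbers q
  open SubspaceCounting F n using (containing-falling)
  open Points F n
  open RationalSums
  open GaussianBinomials q

  2≤q : 2 ≤ q
  2≤q = distinct⇒2≤length (complete _) (complete _) 0≢1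

  instance
    q-nonZero : NonZero q
    q-nonZero = ℕ.>-nonZero (≤-trans (s≤s z≤n) 2≤q)
    q-1-nonZero : NonZero (pred q)
    q-1-nonZero = ℕ.>-nonZero (pred-mono-≤ 2≤q)

  module _ (ps : List SubsetV) (enP : Enumerates (IsSubspaceOfDim 1) ps)
           (ks : List SubsetV) (enK : Enumerates (IsSubspaceOfDim k) ks) where
    private
      isSubspace = proj₁ (proj₂ enK)

    incident : Fin (length ps) → Fin (length ks) → Bool
    incident i s = lookup ps i ⊆ᵇ lookup ks s

    through : Fin (length ps) → ℕ
    through i = count (incident i) (allFin (length ks))

    throughBoth : Fin (length ps) → Fin (length ps) → ℕ
    throughBoth i j = count (λ s → incident i s ∧ incident j s) (allFin (length ks))

    incident≡allInᵇ : ∀ i s → incident i s ≡ lookup ks s (generator ps enP i) ∧ true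
    incident≡allInᵇ i s = ⊆ᵇ-spanned (generator ps enP i ∷ []) (generates ps enP i) (isSubspace s)

    through-falling : ∀ i → through i * falling (suc k′) (suc k′) ≡ falling (suc n′) (suc k′)
    through-falling i = trans
      (cong (_* falling (suc k′) (suc k′)) (count-cong (allFin (length ks)) (λ {s} _ → incident≡allInᵇ i s)))
      (containing-falling (+-comm (suc k′) 1) k≤n′ ks enK (generator ps enP i ∷ []) (independent ps enP i))
      where k≤n′ = s≤s (s≤s k≤n)

    throughBoth-falling : ∀ {i j} → i ≢ j → throughBoth i j * falling k′ k′ ≡ falling n′ k′
    throughBoth-falling {i} {j} i≢j = trans
      (cong (_* falling k′ k′) (count-cong (allFin (length ks)) (λ {s} _ →
        cong₂ _∧_ (trans (incident≡allInᵇ i s) (∧-identityʳ _)) (incident≡allInᵇ j s))))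
      (containing-falling (+-comm k′ 2) k≤n′ ks enK (generator ps enP i ∷ generator ps enP j ∷ [])
                          (generators-independent ps enP i≢j))
      where k≤n′ = s≤s (s≤s k≤n)

    through-ratio : ∀ {i j} → i ≢ j → through i * [ suc k′ ] ≡ [ suc n′ ] * throughBoth i j
    through-ratio {i} {j} i≢j = *-cancelʳ-≡ _ _ (falling k′ k′) {{falling-nonZero {k′} {k′} ≤-refl}} (begin
      through i * [ suc k′ ] * falling k′ k′              ≡⟨ *-assoc (through i) [ suc k′ ] (falling k′ k′) ⟩
      through i * ([ suc k′ ] * falling k′ k′)            ≡⟨ cong (through i *_) (falling-suc k′ k′) ⟨
      through i * falling (suc k′) (suc k′)               ≡⟨ through-falling i ⟩
      falling (suc n′) (suc k′)                           ≡⟨ falling-suc n′ k′ ⟩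
      [ suc n′ ] * falling n′ k′                          ≡⟨ cong ([ suc n′ ] *_) (throughBoth-falling i≢j) ⟨
      [ suc n′ ] * (throughBoth i j * falling k′ k′)      ≡⟨ *-assoc [ suc n′ ] (throughBoth i j) (falling k′ k′) ⟨
      [ suc n′ ] * throughBoth i j * falling k′ k′        ∎)
      where open ≡-Reasoning

    g φ : ℚ
    g = gauss q (suc n′) (suc k′)
    φ = qfrac q (suc k′) (suc n′)

    through-gauss : ∀ i → toℚ (through i) ≡ g
    through-gauss i = *-cancelʳ-≡-pos (toℚ (falling (suc k′) (suc k′))) {{toℚ-positive _ {{falling-nonZero {suc k′} ≤-refl}}}} (begin
      toℚ (through i) *ℚ toℚ (falling (suc k′) (suc k′))   ≡⟨ toℚ-* (through i) _ ⟨
      toℚ (through i * falling (suc k′) (suc k′))          ≡⟨ cong toℚ (through-falling i) ⟩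
      toℚ (falling (suc n′) (suc k′))                      ≡⟨ gauss-falling (suc n′) (suc k′) ⟨
      g *ℚ toℚ (falling (suc k′) (suc k′))                 ∎)
      where open ≡-Reasoning

    throughBoth-gauss : ∀ {i j} → i ≢ j → toℚ (throughBoth i j) ≡ g *ℚ φ
    throughBoth-gauss {i} {j} i≢j = *-cancelʳ-≡-pos (toℚ [ suc n′ ]) {{toℚ-positive _}} (begin
      toℚ (throughBoth i j) *ℚ toℚ [ suc n′ ]   ≡⟨ toℚ-* (throughBoth i j) _ ⟨
      toℚ (throughBoth i j * [ suc n′ ])        ≡⟨ cong toℚ (trans (*-comm (throughBoth i j) _) (sym (through-ratio i≢j))) ⟩
      toℚ (through i * [ suc k′ ])              ≡⟨ toℚ-* (through i) _ ⟩
      toℚ (through i) *ℚ toℚ [ suc k′ ]         ≡⟨ cong₂ _*ℚ_ (sym (through-gauss i)) (qfrac-* (suc k′) n′) ⟨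
      g *ℚ (φ *ℚ toℚ [ suc n′ ])                ≡⟨ ℚ.*-assoc g φ _ ⟨
      g *ℚ φ *ℚ toℚ [ suc n′ ]                  ∎)
      where open ≡-Reasoning

    g-positive : Fin (length ps) → Positive g
    g-positive i = subst Positive (through-gauss i) (toℚ-positive (through i) {{through-nonZero}})
      where
      through-nonZero : NonZero (through i)
      through-nonZero = m*n≢0⇒m≢0 (through i) {{subst NonZero (sym (through-falling i)) (falling-nonZero (s≤s k≤n))}}

    module _ (wt : Fin (length ps) → ℚ) where

      f : Fin (length ks) → ℚ
      f s = wtOf ps wt (lookup ks s)

      W : ℚ
      W = ∑[ j < length ps ] wt j

      sum-selected : (b : Fin (length ks) → Bool) →
        ∑[ s < length ks ] (if b s then f s else 0ℚ)
          ≡ ∑[ j < length ps ] (toℚ (count (λ s → b s ∧ incident j s) (allFin (length ks))) *ℚ wt j)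
      sum-selected b = begin
        ∑[ s < length ks ] (if b s then f s else 0ℚ)
          ≡⟨ sum-cong-≗ by-points ⟩
        ∑[ s < length ks ] ∑[ j < length ps ] (if b s ∧ incident j s then wt j else 0ℚ)
          ≡⟨ ∑-comm (λ s j → if b s ∧ incident j s then wt j else 0ℚ) ⟩
        ∑[ j < length ps ] ∑[ s < length ks ] (if b s ∧ incident j s then wt j else 0ℚ)
          ≡⟨ sum-cong-≗ (λ j → sum-if (λ s → b s ∧ incident j s) (wt j)) ⟩
        ∑[ j < length ps ] (toℚ (count (λ s → b s ∧ incident j s) (allFin (length ks))) *ℚ wt j) ∎
        where
        open ≡-Reasoning
        by-points : ∀ s → (if b s then f s else 0ℚ) ≡ ∑[ j < length ps ] (if b s ∧ incident j s then wt j else 0ℚ)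
        by-points s with b s
        ... | true  = foldr-map-allFin (λ j → if incident j s then wt j else 0ℚ)
        ... | false = sym (sum-replicate-zero (length ps))

      sum-all : ∑[ s < length ks ] f s ≡ g *ℚ W
      sum-all = begin
        ∑[ s < length ks ] f s                           ≡⟨ sum-selected (λ _ → true) ⟩
        ∑[ j < length ps ] (toℚ (through j) *ℚ wt j)     ≡⟨ sum-cong-≗ (λ j → cong (_*ℚ wt j) (through-gauss j)) ⟩
        ∑[ j < length ps ] (g *ℚ wt j)                   ≡⟨ *-distribˡ-sum g wt ⟨
        g *ℚ W                                           ∎
        where open ≡-Reasoning

      sum-through : ∀ i → ∑[ s < length ks ] (if incident i s then f s else 0ℚ) ≡ g *ℚ (wt i + φ *ℚ (W - wt i))
      sum-through i = begin
        ∑[ s < length ks ] (if incident i s then f s else 0ℚ)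
          ≡⟨ sum-selected (incident i) ⟩
        ∑[ j < length ps ] (toℚ (throughBoth i j) *ℚ wt j)
          ≡⟨ sum-except _ (λ j → g *ℚ φ *ℚ wt j) i (λ j j≢i → cong (_*ℚ wt j) (throughBoth-gauss (j≢i ∘ sym))) ⟩
        toℚ (throughBoth i i) *ℚ wt i + (∑[ j < length ps ] (g *ℚ φ *ℚ wt j) - g *ℚ φ *ℚ wt i)
          ≡⟨ cong₂ (λ a b → a *ℚ wt i + (b - g *ℚ φ *ℚ wt i)) through-i-i (sym (*-distribˡ-sum (g *ℚ φ) wt)) ⟩
        g *ℚ wt i + (g *ℚ φ *ℚ W - g *ℚ φ *ℚ wt i)
          ≡⟨ solve 4 (λ g φ w W → g :* w :+ (g :* φ :* W :- g :* φ :* w) := g :* (w :+ φ :* (W :- w))) refl g φ (wt i) W ⟩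
        g *ℚ (wt i + φ *ℚ (W - wt i)) ∎
        where
        open ≡-Reasoning
        open ℚ-Solver
        through-i-i : toℚ (throughBoth i i) ≡ g
        through-i-i = trans (cong toℚ (count-cong (allFin (length ks)) (λ {s} _ → ∧-idem (incident i s)))) (through-gauss i)

      module _ (h01 : ∀ s → f s ≡ 0ℚ ⊎ f s ≡ 1ℚ) where

        size≡sum : toℚ (sizeY ps wt ks) ≡ ∑[ s < length ks ] f s
        size≡sum = trans (count-ones (wtOf ps wt) ks h01′) (foldr-map-lookup ks (wtOf ps wt))
          where
          h01′ : ∀ {S} → S ∈ ks → wtOf ps wt S ≡ 0ℚ ⊎ wtOf ps wt S ≡ 1ℚ
          h01′ S∈ks rewrite lookup-index S∈ks = h01 (index S∈ks)

        sum-through-bounds : ∀ i → 0ℚ ≤ℚ g *ℚ (wt i + φ *ℚ (W - wt i)) × g *ℚ (wt i + φ *ℚ (W - wt i)) ≤ℚ g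
        sum-through-bounds i with sum-if-bounds (incident i) f f∈[0,1]
          where
          f∈[0,1] : ∀ s → 0ℚ ≤ℚ f s × f s ≤ℚ 1ℚ
          f∈[0,1] s with h01 s
          ... | inj₁ fs≡0 = ℚ.≤-reflexive (sym fs≡0) , subst (_≤ℚ 1ℚ) (sym fs≡0) (ℚ.nonNegative⁻¹ 1ℚ)
          ... | inj₂ fs≡1 = subst (0ℚ ≤ℚ_) (sym fs≡1) (ℚ.nonNegative⁻¹ 1ℚ) , ℚ.≤-reflexive fs≡1
        ... | lower , upper = subst (0ℚ ≤ℚ_) (sum-through i) lower
                            , subst₂ _≤ℚ_ (sum-through i) (through-gauss i) upper

        weight-bounds : (x : ℚ) → toℚ (sizeY ps wt ks) ≡ x *ℚ g → ∀ i →
          0ℚ ≤ℚ wt i + φ *ℚ (x - wt i) × wt i + φ *ℚ (x - wt i) ≤ℚ 1ℚ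
        weight-bounds x |Y|≡xg i = subst (λ y → 0ℚ ≤ℚ wt i + φ *ℚ (y - wt i) × wt i + φ *ℚ (y - wt i) ≤ℚ 1ℚ) (sym x≡W)
          ( ℚ.*-cancelˡ-≤-pos g {{g-positive i}} (subst (_≤ℚ g *ℚ E) (sym (ℚ.*-zeroʳ g)) (proj₁ (sum-through-bounds i)))
          , ℚ.*-cancelˡ-≤-pos g {{g-positive i}} (subst (g *ℚ E ≤ℚ_) (sym (ℚ.*-identityʳ g)) (proj₂ (sum-through-bounds i))))
          where
          E = wt i + φ *ℚ (W - wt i)
          x≡W : x ≡ W
          x≡W = *-cancelʳ-≡-pos g {{g-positive i}} (trans (sym |Y|≡xg) (trans size≡sum (trans sum-all (ℚ.*-comm g W))))

open import Data.Nat using (ℕ; _≤_; _*_; _∸_)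
open import Data.Rational using (ℚ; 0ℚ; 1ℚ; _+_; _-_; _/_) renaming (_*_ to _*ℚ_; _≤_ to _≤ℚ_)
open import Data.Fin using (Fin)
open import Data.Integer using (+_)
open import Data.List using (List; length; lookup)
open import Data.Sum using (_⊎_)
open import Data.Product using (_×_)
open import Relation.Binary.PropositionalEquality using (_≡_)

open import Data.Nat using (suc; s≤s)
open import Data.Nat.Properties using (≤-trans; m≤m+n)
open import Relation.Binary.PropositionalEquality using (trans; sym)

proposition2 : (F : FiniteField) (n k : ℕ) → 2 ≤ k → 2 * k ≤ n →
    let open FiniteField F using (q) in
    let open VectorSpace F n in
    (ps : List SubsetV) → Enumerates (IsSubspaceOfDim 1) ps →
    (ks : List SubsetV) → Enumerates (IsSubspaceOfDim k) ks →
    (wt : Fin (length ps) → ℚ) →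
    (∀ j → wtOf ps wt (lookup ks j) ≡ 0ℚ ⊎ wtOf ps wt (lookup ks j) ≡ 1ℚ) →
    (x : ℚ) → (+ sizeY ps wt ks) / 1 ≡ x *ℚ gauss q (n ∸ 1) (k ∸ 1) →
    (i : Fin (length ps)) →
      (0ℚ ≤ℚ wt i + qfrac q (k ∸ 1) (n ∸ 1) *ℚ (x - wt i))
      × (wt i + qfrac q (k ∸ 1) (n ∸ 1) *ℚ (x - wt i) ≤ℚ 1ℚ)
proposition2 F (suc (suc n′)) (suc (suc k′)) (s≤s (s≤s _)) (s≤s (s≤s 2k≤n)) ps enP ks enK wt h01 x |Y|≡xg =
  weight-bounds ps enP ks enK wt h01 x (trans (sym (/1≡toℚ _)) |Y|≡xg)
  where
  open RationalSums using (/1≡toℚ)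
  open PointWeights F n′ k′ (≤-trans (m≤m+n k′ _) 2k≤n)
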